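{- Let $G_1$ be an $r_1$-regular graph with $r_1\ge 1$, having $n_1$ vertices $v_1,\dots,v_{n_1}$ and $m_1$ edges, and let $G_2$ be an arbitrary graph with $n_2\ge 1$ vertices $w_1,\dots,w_{n_2}$. Let $G_1\diamond G_2$ be the neighborhood corona of $G_1$ and $G_2$, with its vertices ordered as $v_1,\dots,v_{n_1}$, followed by $U_1,U_2,\dots,U_{n_2}$, where $U_j=(w^1_j,w^2_j,\dots,w^{n_1}_j)$. Define $$L_1=L(G_1)+n_2D(G_1),\qquad L_2=-\mathbf{1}^T_{n_2}\otimes A(G_1),\qquad L_3=L(G_2)\otimes I_{n_1}+I_{n_2}\otimes D(G_1),$$ $$S=L_3-J_{n_2\times n_2}\otimes\big[A(G_1)^TL_1^{ -1}A(G_1)\big].$$ Then, with respect to this vertex ordering, the matrix $$\begin{pmatrix} L_1^{ -1}+L_1^{ -1}L_2S^{\#}L_2^TL_1^{ -1} & -L_1^{ -1}L_2S^{\#}\\ -S^{\#}L_2^TL_1^{ -1} & S^{\#}\end{pmatrix}$$ is a symmetric $\{1\}$-inverse of the Laplacian matrix $L(G_1\diamond G_2)$.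
   Context: All graphs are simple and undirected. For a graph $G$, $A(G)$ is its adjacency matrix, $D(G)$ the diagonal matrix of vertex degrees, and $L(G)=D(G)-A(G)$ its Laplacian matrix. The neighborhood corona $G_1\diamond G_2$ of graphs $G_1$ (on $n_1$ vertices) and $G_2$ (on $n_2$ vertices) is the graph obtained by taking one copy of $G_1$ and $n_1$ copies of $G_2$ and joining every neighbor (in $G_1$) of the $i$-th vertex $v_i$ of $G_1$ to every vertex in the $i$-th copy of $G_2$ by a new edge; $w^i_j$ denotes the copy of $w_j$ in the $i$-th copy of $G_2$. $\mathbf{1}_n$ is the all-ones column vector of length $n$, $J_{n\times n}$ the all-ones $n\times n$ matrix, $I_n$ the identity matrix, and $\otimes$ the Kronecker product ($A\otimes B$ is obtained from $A$ by replacing each entry $a_{ij}$ by the block $a_{ij}B$). A matrix $X$ is a $\{1\}$-inverse of $A$ if $AXA=A$. For a square matrix $S$, the group inverse $S^{\#}$ is the unique matrix $X$ with $SXS=S$, $XSX=X$, $SX=XS$ (for real symmetric $S$ it exists and equals the Moore–Penrose inverse). -}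

module Defs where

open import Data.Nat as ℕ using (ℕ; zero; suc)
open import Data.Bool using (Bool; true; false; if_then_else_)
open import Data.Fin using (Fin; zero; suc; splitAt; remQuot; _≟_)
open import Data.Sum using (inj₁; inj₂)
open import Data.Product using (_×_; _,_; Σ-syntax)
open import Relation.Nullary.Decidable using (⌊_⌋)
open import Relation.Binary.PropositionalEquality using (_≡_)
open import Data.Rational using (ℚ; 0ℚ; 1ℚ; _+_; _*_; -_; _-_)
import Data.Rational as Q
import Data.Integer

-- Simple undirected graphs on vertex set Fin n (vertex i = v_{i+1})

record Graph (n : ℕ) : Set where
  field
    adj     : Fin n → Fin n → Bool
    adj-sym : ∀ i j → adj i j ≡ adj j i
    adj-irr : ∀ i → adj i i ≡ false
open Graph public

countFin : ∀ {n} → (Fin n → Bool) → ℕ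
countFin {zero}  f = 0
countFin {suc n} f = (if f zero then 1 else 0) ℕ.+ countFin (λ i → f (suc i))

sumFin : ∀ {n} → (Fin n → ℚ) → ℚ
sumFin {zero}  f = 0ℚ
sumFin {suc n} f = f zero + sumFin (λ i → f (suc i))

degree : ∀ {n} → Graph n → Fin n → ℕ
degree G i = countFin (adj G i)

IsRegular : ∀ {n} → Graph n → ℕ → Set
IsRegular G r = ∀ i → degree G i ≡ r

Matrix : ℕ → ℕ → Set
Matrix m n = Fin m → Fin n → ℚ

_≈ₘ_ : ∀ {m n} → Matrix m n → Matrix m n → Set
M ≈ₘ N = ∀ i j → M i j ≡ N i j

_⊕_ : ∀ {m n} → Matrix m n → Matrix m n → Matrix m n
(M ⊕ N) i j = M i j + N i j

_⊖_ : ∀ {m n} → Matrix m n → Matrix m n → Matrix m n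
(M ⊖ N) i j = M i j - N i j

negM : ∀ {m n} → Matrix m n → Matrix m n
negM M i j = - (M i j)

scal : ∀ {m n} → ℚ → Matrix m n → Matrix m n
scal c M i j = c * M i j

_⊗ₘ_ : ∀ {m n p} → Matrix m n → Matrix n p → Matrix m p
(M ⊗ₘ N) i k = sumFin (λ j → M i j * N j k)

_ᵀ : ∀ {m n} → Matrix m n → Matrix n m
(M ᵀ) i j = M j i

δ : ∀ {n} → Fin n → Fin n → ℚ
δ i j = if ⌊ i ≟ j ⌋ then 1ℚ else 0ℚ

Id : ∀ n → Matrix n n
Id n = δ

J : ∀ m n → Matrix m n
J m n i j = 1ℚ

-- Kronecker product for square matrices: (A ⊗ B) indexed by Fin (m * n),
-- where combine i k = i*n + k (Data.Fin.combine / remQuot)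
kron : ∀ {m n} → Matrix m m → Matrix n n → Matrix (m ℕ.* n) (m ℕ.* n)
kron {m} {n} A B x y with remQuot {m} n x | remQuot {m} n y
... | (i , k) | (j , l) = A i j * B k l

block : ∀ {m n} → Matrix m m → Matrix m n → Matrix n m → Matrix n n
      → Matrix (m ℕ.+ n) (m ℕ.+ n)
block {m} P Q R T x y with splitAt m x | splitAt m y
... | inj₁ i | inj₁ j = P i j
... | inj₁ i | inj₂ j = Q i j
... | inj₂ i | inj₁ j = R i j
... | inj₂ i | inj₂ j = T i j

b2q : Bool → ℚ
b2q true  = 1ℚ
b2q false = 0ℚ

AdjM : ∀ {n} → Graph n → Matrix n n
AdjM G i j = b2q (adj G i j)

DegM : ∀ {n} → Graph n → Matrix n n
DegM G i j = if ⌊ i ≟ j ⌋ then (Data.Integer.+ (degree G i) Q./ 1) else 0ℚ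

Lap : ∀ {n} → Graph n → Matrix n n
Lap G = DegM G ⊖ AdjM G

-- Neighborhood corona G1 ⋄ G2 on Fin (n1 + n2 * n1):
-- index i < n1 is v_{i+1}; index n1 + combine j i (= n1 + j*n1 + i) is w^{i}_{j}
-- (the copy of w_j in the i-th copy of G2), i.e. ordering v's, then U_1,...,U_{n2}.

coronaAdj : ∀ {n1 n2} → Graph n1 → Graph n2
          → Fin (n1 ℕ.+ n2 ℕ.* n1) → Fin (n1 ℕ.+ n2 ℕ.* n1) → Bool
coronaAdj {n1} {n2} G1 G2 x y with splitAt n1 x | splitAt n1 y
... | inj₁ a | inj₁ b = adj G1 a b
... | inj₁ a | inj₂ c with remQuot {n2} n1 c
...   | (j , i) = adj G1 a i
coronaAdj {n1} {n2} G1 G2 x y | inj₂ c | inj₁ b with remQuot {n2} n1 c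
...   | (j , i) = adj G1 i b
coronaAdj {n1} {n2} G1 G2 x y | inj₂ c | inj₂ d with remQuot {n2} n1 c | remQuot {n2} n1 d
...   | (j , i) | (j' , i') = if ⌊ i ≟ i' ⌋ then adj G2 j j' else false

LapCorona : ∀ {n1 n2} → Graph n1 → Graph n2
          → Matrix (n1 ℕ.+ n2 ℕ.* n1) (n1 ℕ.+ n2 ℕ.* n1)
LapCorona G1 G2 x y =
  (if ⌊ x ≟ y ⌋ then (Data.Integer.+ (countFin (coronaAdj G1 G2 x)) Q./ 1) else 0ℚ)
  - b2q (coronaAdj G1 G2 x y)

IsInverse : ∀ {n} → Matrix n n → Matrix n n → Set
IsInverse {n} M X = ((M ⊗ₘ X) ≈ₘ Id n) × ((X ⊗ₘ M) ≈ₘ Id n)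

Is1Inverse : ∀ {m n} → Matrix m n → Matrix n m → Set
Is1Inverse A X = ((A ⊗ₘ X) ⊗ₘ A) ≈ₘ A

IsGroupInverse : ∀ {n} → Matrix n n → Matrix n n → Set
IsGroupInverse S X =
  (((S ⊗ₘ X) ⊗ₘ S) ≈ₘ S) × (((X ⊗ₘ S) ⊗ₘ X) ≈ₘ X) × ((S ⊗ₘ X) ≈ₘ (X ⊗ₘ S))

IsSymmetric : ∀ {n} → Matrix n n → Set
IsSymmetric X = (X ᵀ) ≈ₘ X

L₁ : ∀ {n1} → Graph n1 → ℕ → Matrix n1 n1
L₁ G1 n2 = Lap G1 ⊕ scal (Data.Integer.+ (n2) Q./ 1) (DegM G1)

-- L2 = - 1ᵀ_{n2} ⊗ A(G1)  (n1 × n2 n1): entry at (a, combine j i) is -A(G1)_{a i}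
L₂ : ∀ {n1} n2 → Graph n1 → Matrix n1 (n2 ℕ.* n1)
L₂ {n1} n2 G1 a c with remQuot {n2} n1 c
... | (j , i) = - (1ℚ * AdjM G1 a i)

L₃ : ∀ {n1 n2} → Graph n1 → Graph n2 → Matrix (n2 ℕ.* n1) (n2 ℕ.* n1)
L₃ {n1} {n2} G1 G2 = kron (Lap G2) (Id n1) ⊕ kron (Id n2) (DegM G1)

Sₘ : ∀ {n1 n2} → Graph n1 → Graph n2 → Matrix n1 n1 → Matrix (n2 ℕ.* n1) (n2 ℕ.* n1)
Sₘ {n1} {n2} G1 G2 L1inv =
  L₃ G1 G2 ⊖ kron (J n2 n2) (((AdjM G1 ᵀ) ⊗ₘ L1inv) ⊗ₘ AdjM G1)

Mblock : ∀ {n1 n2} → Graph n1 → Graph n2 → Matrix n1 n1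
       → Matrix (n2 ℕ.* n1) (n2 ℕ.* n1)
       → Matrix (n1 ℕ.+ n2 ℕ.* n1) (n1 ℕ.+ n2 ℕ.* n1)
Mblock {n1} {n2} G1 G2 L1inv Sh =
  block (L1inv ⊕ ((((L1inv ⊗ₘ L2) ⊗ₘ Sh) ⊗ₘ (L2 ᵀ)) ⊗ₘ L1inv))
        (negM ((L1inv ⊗ₘ L2) ⊗ₘ Sh))
        (negM ((Sh ⊗ₘ (L2 ᵀ)) ⊗ₘ L1inv))
        Sh
  where L2 = L₂ n2 G1

-- With the vertices ordered v, U_1, ..., U_n2, the Laplacian of G1 ⋄ G2 is the block matrix
-- [[L1, L2], [L2ᵀ, L3]]: v_i gains n2 deg(v_i) neighbours among the copies of G2, and w^i_j has
-- deg(v_i) + deg(w_j) neighbours. S is the Schur complement L3 − L2ᵀ L1⁻¹ L2, and for every block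
-- matrix [[A, B], [Bᵀ, C]] with A invertible and every X with S X S = S the displayed matrix is a
-- {1}-inverse, symmetric when A⁻¹ and X are. As G1 is r1-regular, L1 = (1 + n2) r1 I − A(G1) is
-- symmetric and strictly diagonally dominant, hence invertible. Over ℚ every matrix has a
-- Moore–Penrose inverse (Greville's column recursion); for the symmetric S it is symmetric and
-- therefore a group inverse, and by uniqueness every group inverse of S is symmetric.

module Submission where

open import Defs
open import Data.Nat using (ℕ; _≤_; _*_)
open import Data.Product using (_×_; Σ-syntax)

open import Algebra.Bundles using (CommutativeRing)
import Algebra.Properties.Group as GroupProperties
import Algebra.Properties.Semiring.Sum as SemiringSum
open import Data.Bool using (Bool; true; false; if_then_else_)
open import Data.Empty using (⊥-elim)
open import Data.Fin using (Fin; zero; suc; splitAt; remQuot; combine; join; _↑ˡ_; _↑ʳ_; _≟_)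
import Data.Fin.Properties as Finₚ
open import Data.Nat using (zero; suc)
import Data.Nat as ℕ
import Data.Integer as ℤ
import Data.Integer.Properties as ℤₚ
open import Data.Nat.Coprimality using (1-coprimeTo) renaming (sym to coprime-sym)
open import Data.Product using (_,_; proj₁; proj₂; ∃-syntax)
open import Data.Rational as ℚ
  using (ℚ; 0ℚ; 1ℚ; _+_; -_; _-_; _/_; ∣_∣; 1/_; NonZero)
  renaming (_*_ to _·_; _≤_ to _≤ℚ_; _<_ to _<ℚ_)
import Data.Rational.Properties as ℚₚ
open import Data.Rational.Solver using (module +-*-Solver)
open +-*-Solver using (solve; _:+_; _:*_; :-_; _:=_; con)
open import Data.Sum using (inj₁; inj₂)
open import Function using (_∘_)
open import Relation.Binary.Bundles using (Setoid)
open import Relation.Nullary using (¬_; yes; no)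
open import Relation.Nullary.Decidable using (⌊_⌋)
open import Relation.Binary.PropositionalEquality
  using (_≡_; refl; sym; trans; cong; cong₂; subst; subst₂; module ≡-Reasoning)

open GroupProperties ℚₚ.+-0-group using () renaming (x∙y⁻¹≈ε⇒x≈y to p-q≡0⇒p≡q)

module ℚΣ = SemiringSum (CommutativeRing.semiring ℚₚ.+-*-commutativeRing)

sumFin≗sum : ∀ {n} (f : Fin n → ℚ) → sumFin f ≡ ℚΣ.sum f
sumFin≗sum {zero}  f = refl
sumFin≗sum {suc n} f = cong (f zero +_) (sumFin≗sum (f ∘ suc))

sum-cong : ∀ {n} {f g : Fin n → ℚ} → (∀ i → f i ≡ g i) → sumFin f ≡ sumFin g
sum-cong {zero}  e = refl
sum-cong {suc n} e = cong₂ _+_ (e zero) (sum-cong (e ∘ suc))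

sum-zero : ∀ {n} {f : Fin n → ℚ} → (∀ i → f i ≡ 0ℚ) → sumFin f ≡ 0ℚ
sum-zero {zero}  e = refl
sum-zero {suc n} e = trans (cong₂ _+_ (e zero) (sum-zero (e ∘ suc))) (ℚₚ.+-identityˡ 0ℚ)

sum-+ : ∀ {n} (f g : Fin n → ℚ) → sumFin (λ i → f i + g i) ≡ sumFin f + sumFin g
sum-+ f g = begin
  sumFin (λ i → f i + g i)  ≡⟨ sumFin≗sum (λ i → f i + g i) ⟩
  ℚΣ.sum (λ i → f i + g i)  ≡⟨ ℚΣ.∑-distrib-+ f g ⟩
  ℚΣ.sum f + ℚΣ.sum g       ≡⟨ sym (cong₂ _+_ (sumFin≗sum f) (sumFin≗sum g)) ⟩
  sumFin f + sumFin g       ∎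
  where open ≡-Reasoning

*-distribˡ-sum : ∀ {n} c (f : Fin n → ℚ) → c · sumFin f ≡ sumFin (λ i → c · f i)
*-distribˡ-sum c f = trans (cong (c ·_) (sumFin≗sum f))
  (trans (ℚΣ.*-distribˡ-sum c f) (sym (sumFin≗sum (λ i → c · f i))))

*-distribʳ-sum : ∀ {n} c (f : Fin n → ℚ) → sumFin f · c ≡ sumFin (λ i → f i · c)
*-distribʳ-sum c f = trans (cong (_· c) (sumFin≗sum f))
  (trans (ℚΣ.*-distribʳ-sum c f) (sym (sumFin≗sum (λ i → f i · c))))

neg-distrib-sum : ∀ {n} (f : Fin n → ℚ) → - sumFin f ≡ sumFin (λ i → - f i)
neg-distrib-sum {zero}  f = refl
neg-distrib-sum {suc n} f =
  trans (ℚₚ.neg-distrib-+ (f zero) _) (cong (- f zero +_) (neg-distrib-sum (f ∘ suc)))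

sum-comm : ∀ {m n} (f : Fin m → Fin n → ℚ) →
           sumFin (λ i → sumFin (f i)) ≡ sumFin (λ j → sumFin (λ i → f i j))
sum-comm f = begin
  sumFin (λ i → sumFin (f i))          ≡⟨ sumFin≗sum (λ i → sumFin (f i)) ⟩
  ℚΣ.sum (λ i → sumFin (f i))          ≡⟨ ℚΣ.sum-cong-≗ (λ i → sumFin≗sum (f i)) ⟩
  ℚΣ.sum (λ i → ℚΣ.sum (f i))          ≡⟨ ℚΣ.∑-comm f ⟩
  ℚΣ.sum (λ j → ℚΣ.sum (λ i → f i j))  ≡⟨ ℚΣ.sum-cong-≗ (λ j → sumFin≗sum (λ i → f i j)) ⟨
  ℚΣ.sum (λ j → sumFin (λ i → f i j))  ≡⟨ sumFin≗sum (λ j → sumFin (λ i → f i j)) ⟨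
  sumFin (λ j → sumFin (λ i → f i j))  ∎
  where open ≡-Reasoning

sum-↑ : ∀ m {n} (f : Fin (m ℕ.+ n) → ℚ) →
        sumFin f ≡ sumFin (λ i → f (i ↑ˡ n)) + sumFin (λ j → f (m ↑ʳ j))
sum-↑ zero    f = sym (ℚₚ.+-identityˡ _)
sum-↑ (suc m) f = trans (cong (f zero +_) (sum-↑ m (f ∘ suc))) (sym (ℚₚ.+-assoc (f zero) _ _))

sum-combine : ∀ m n (f : Fin (m ℕ.* n) → ℚ) →
              sumFin f ≡ sumFin (λ i → sumFin (λ j → f (combine {m} {n} i j)))
sum-combine zero    n f = refl
sum-combine (suc m) n f = trans (sum-↑ n f) (cong (sumFin (λ j → f (j ↑ˡ (m ℕ.* n))) +_)
  (sum-combine m n (λ k → f (n ↑ʳ k))))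

δ-diag : ∀ {n} (i : Fin n) → δ i i ≡ 1ℚ
δ-diag i with i ≟ i
... | yes _ = refl
... | no i≢i = ⊥-elim (i≢i refl)

δ-≢ : ∀ {n} {i j : Fin n} → ¬ i ≡ j → δ i j ≡ 0ℚ
δ-≢ {i = i} {j} i≢j with i ≟ j
... | yes i≡j = ⊥-elim (i≢j i≡j)
... | no _    = refl

δ-injective : ∀ {m n} (f : Fin m → Fin n) → (∀ {x y} → f x ≡ f y → x ≡ y) →
              ∀ x y → δ (f x) (f y) ≡ δ x y
δ-injective f f-inj x y with x ≟ y
... | yes refl = δ-diag (f x)
... | no x≢y   = δ-≢ (x≢y ∘ f-inj)

δ-sym : ∀ {n} (i j : Fin n) → δ i j ≡ δ j i
δ-sym i j with i ≟ j
... | yes refl = sym (δ-diag i)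
... | no i≢j   = sym (δ-≢ (i≢j ∘ sym))

δ-combine : ∀ {m n} (j j′ : Fin m) (i i′ : Fin n) →
            δ (combine j i) (combine j′ i′) ≡ δ j j′ · δ i i′
δ-combine j j′ i i′ with j ≟ j′
... | no j≢j′ = trans (δ-≢ (j≢j′ ∘ proj₁ ∘ Finₚ.combine-injective j i j′ i′))
                      (sym (ℚₚ.*-zeroˡ (δ i i′)))
... | yes refl with i ≟ i′
...   | yes refl = δ-diag (combine j i)
...   | no i≢i′  = trans (δ-≢ (i≢i′ ∘ proj₂ ∘ Finₚ.combine-injective j i j i′))
                         (sym (ℚₚ.*-zeroʳ 1ℚ))

δ-·-subst : ∀ {n} (i j : Fin n) (f : Fin n → ℚ) → δ i j · f i ≡ δ i j · f j
δ-·-subst i j f with i ≟ j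
... | yes refl = refl
... | no _     = trans (ℚₚ.*-zeroˡ (f i)) (sym (ℚₚ.*-zeroˡ (f j)))

if-≟-δ : ∀ {n} (i j : Fin n) (x : ℚ) → (if ⌊ i ≟ j ⌋ then x else 0ℚ) ≡ δ i j · x
if-≟-δ i j x with i ≟ j
... | yes _ = sym (ℚₚ.*-identityˡ x)
... | no _  = sym (ℚₚ.*-zeroˡ x)

sum-δˡ : ∀ {n} (i : Fin n) (f : Fin n → ℚ) → sumFin (λ j → δ i j · f j) ≡ f i
sum-δˡ zero f = trans (cong₂ _+_ (ℚₚ.*-identityˡ (f zero)) (sum-zero (λ j → ℚₚ.*-zeroˡ (f (suc j)))))
  (ℚₚ.+-identityʳ (f zero))
sum-δˡ (suc i) f = trans (cong₂ _+_ (ℚₚ.*-zeroˡ (f zero)) (trans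
    (sum-cong (λ j → cong (_· f (suc j)) (δ-injective suc Finₚ.suc-injective i j)))
    (sum-δˡ i (f ∘ suc))))
  (ℚₚ.+-identityˡ (f (suc i)))

-- Defs fixes no precedences for its matrix operators; these aliases do.
infix  4 _≈_
infixl 7 _⊗_

_≈_ : ∀ {m n} → Matrix m n → Matrix m n → Set
_≈_ = _≈ₘ_

_⊗_ : ∀ {m n p} → Matrix m n → Matrix n p → Matrix m p
_⊗_ = _⊗ₘ_

≈-setoid : ℕ → ℕ → Setoid _ _
≈-setoid m n = record
  { Carrier       = Matrix m n
  ; _≈_           = _≈_
  ; isEquivalence = record
    { refl  = λ i j → refl
    ; sym   = λ e i j → sym (e i j)
    ; trans = λ e f i j → trans (e i j) (f i j)
    }
  }

module _ {m n : ℕ} where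
  open Setoid (≈-setoid m n) public
    using () renaming (refl to ≈-refl; sym to ≈-sym; trans to ≈-trans)

module ≈-Reasoning {m n : ℕ} where
  open import Relation.Binary.Reasoning.Setoid (≈-setoid m n) public

0M : ∀ {m n} → Matrix m n
0M i j = 0ℚ

⊗-cong : ∀ {m n p} {A A′ : Matrix m n} {B B′ : Matrix n p} → A ≈ A′ → B ≈ B′ → A ⊗ B ≈ A′ ⊗ B′
⊗-cong e f i k = sum-cong (λ j → cong₂ _·_ (e i j) (f j k))

⊗-congˡ : ∀ {m n p} (A : Matrix m n) {B B′ : Matrix n p} → B ≈ B′ → A ⊗ B ≈ A ⊗ B′
⊗-congˡ A = ⊗-cong (≈-refl {x = A})

⊗-congʳ : ∀ {m n p} {A A′ : Matrix m n} (B : Matrix n p) → A ≈ A′ → A ⊗ B ≈ A′ ⊗ B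
⊗-congʳ B e = ⊗-cong e (≈-refl {x = B})

ᵀ-cong : ∀ {m n} {A A′ : Matrix m n} → A ≈ A′ → (A ᵀ) ≈ (A′ ᵀ)
ᵀ-cong e i j = e j i

⊗-assoc : ∀ {m n p q} (A : Matrix m n) (B : Matrix n p) (C : Matrix p q) →
          A ⊗ B ⊗ C ≈ A ⊗ (B ⊗ C)
⊗-assoc A B C i l = begin
  sumFin (λ k → sumFin (λ j → A i j · B j k) · C k l)
    ≡⟨ sum-cong (λ k → *-distribʳ-sum (C k l) (λ j → A i j · B j k)) ⟩
  sumFin (λ k → sumFin (λ j → A i j · B j k · C k l))
    ≡⟨ sum-comm (λ k j → A i j · B j k · C k l) ⟩
  sumFin (λ j → sumFin (λ k → A i j · B j k · C k l))
    ≡⟨ sum-cong (λ j → trans (sum-cong (λ k → ℚₚ.*-assoc (A i j) (B j k) (C k l)))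
                             (sym (*-distribˡ-sum (A i j) (λ k → B j k · C k l)))) ⟩
  sumFin (λ j → A i j · sumFin (λ k → B j k · C k l))  ∎
  where open ≡-Reasoning

⊗-distribˡ-⊕ : ∀ {m n p} (A : Matrix m n) (B C : Matrix n p) → A ⊗ (B ⊕ C) ≈ (A ⊗ B) ⊕ (A ⊗ C)
⊗-distribˡ-⊕ A B C i k = trans (sum-cong (λ j → ℚₚ.*-distribˡ-+ (A i j) (B j k) (C j k)))
  (sum-+ (λ j → A i j · B j k) (λ j → A i j · C j k))

⊗-distribʳ-⊕ : ∀ {m n p} (A B : Matrix m n) (C : Matrix n p) → (A ⊕ B) ⊗ C ≈ (A ⊗ C) ⊕ (B ⊗ C)
⊗-distribʳ-⊕ A B C i k = trans (sum-cong (λ j → ℚₚ.*-distribʳ-+ (C j k) (A i j) (B i j)))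
  (sum-+ (λ j → A i j · C j k) (λ j → B i j · C j k))

neg-distribʳ-⊗ : ∀ {m n p} (A : Matrix m n) (B : Matrix n p) → A ⊗ negM B ≈ negM (A ⊗ B)
neg-distribʳ-⊗ A B i k = trans (sum-cong (λ j → sym (ℚₚ.neg-distribʳ-* (A i j) (B j k))))
  (sym (neg-distrib-sum (λ j → A i j · B j k)))

neg-distribˡ-⊗ : ∀ {m n p} (A : Matrix m n) (B : Matrix n p) → negM A ⊗ B ≈ negM (A ⊗ B)
neg-distribˡ-⊗ A B i k = trans (sum-cong (λ j → sym (ℚₚ.neg-distribˡ-* (A i j) (B j k))))
  (sym (neg-distrib-sum (λ j → A i j · B j k)))

⊗-distribˡ-⊖ : ∀ {m n p} (A : Matrix m n) (B C : Matrix n p) → A ⊗ (B ⊖ C) ≈ (A ⊗ B) ⊖ (A ⊗ C)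
⊗-distribˡ-⊖ A B C i k =
  trans (⊗-distribˡ-⊕ A B (negM C) i k) (cong ((A ⊗ B) i k +_) (neg-distribʳ-⊗ A C i k))

⊗-distribʳ-⊖ : ∀ {m n p} (A B : Matrix m n) (C : Matrix n p) → (A ⊖ B) ⊗ C ≈ (A ⊗ C) ⊖ (B ⊗ C)
⊗-distribʳ-⊖ A B C i k =
  trans (⊗-distribʳ-⊕ A (negM B) C i k) (cong ((A ⊗ C) i k +_) (neg-distribˡ-⊗ B C i k))

scal-⊗ : ∀ {m n p} c (A : Matrix m n) (B : Matrix n p) → scal c A ⊗ B ≈ scal c (A ⊗ B)
scal-⊗ c A B i k = trans (sum-cong (λ j → ℚₚ.*-assoc c (A i j) (B j k)))
  (sym (*-distribˡ-sum c (λ j → A i j · B j k)))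

⊗-ᵀ : ∀ {m n p} (A : Matrix m n) (B : Matrix n p) → ((A ⊗ B) ᵀ) ≈ (B ᵀ) ⊗ (A ᵀ)
⊗-ᵀ A B k i = sum-cong (λ j → ℚₚ.*-comm (A i j) (B j k))

⊗-identityˡ : ∀ {m n} (A : Matrix m n) → Id m ⊗ A ≈ A
⊗-identityˡ A i k = sum-δˡ i (λ j → A j k)

⊗-identityʳ : ∀ {m n} (A : Matrix m n) → A ⊗ Id n ≈ A
⊗-identityʳ A i k = trans (sum-cong (λ j → trans (ℚₚ.*-comm (A i j) (δ j k)) (cong (_· A i j) (δ-sym j k))))
  (sum-δˡ k (A i))

⊗-zeroˡ : ∀ {m n p} (B : Matrix n p) → 0M {m} ⊗ B ≈ 0M
⊗-zeroˡ B i k = sum-zero (λ j → ℚₚ.*-zeroˡ (B j k))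

⊗-zeroʳ : ∀ {m n p} (A : Matrix m n) → A ⊗ 0M {n} {p} ≈ 0M
⊗-zeroʳ A i k = sum-zero (λ j → ℚₚ.*-zeroʳ (A i j))

Id-symmetric : ∀ n → IsSymmetric (Id n)
Id-symmetric n i j = δ-sym j i

⊗-ᵀ₃ : ∀ {m n p q} (A : Matrix m n) (B : Matrix n p) (C : Matrix p q) →
       ((A ⊗ B ⊗ C) ᵀ) ≈ (C ᵀ) ⊗ (B ᵀ) ⊗ (A ᵀ)
⊗-ᵀ₃ A B C = ≈-trans (⊗-ᵀ (A ⊗ B) C)
  (≈-trans (⊗-congˡ (C ᵀ) (⊗-ᵀ A B)) (≈-sym (⊗-assoc (C ᵀ) (B ᵀ) (A ᵀ))))

IsSymmetric-resp : ∀ {n} {M N : Matrix n n} → M ≈ N → IsSymmetric M → IsSymmetric N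
IsSymmetric-resp M≈N M-sym i j = trans (sym (M≈N j i)) (trans (M-sym i j) (M≈N i j))

-- Moore–Penrose inverses

p*p≡∣p∣*∣p∣ : ∀ p → p · p ≡ ∣ p ∣ · ∣ p ∣
p*p≡∣p∣*∣p∣ p with ℚₚ.∣p∣≡p∨∣p∣≡-p p
... | inj₁ ∣p∣≡p  rewrite ∣p∣≡p  = refl
... | inj₂ ∣p∣≡-p rewrite ∣p∣≡-p = solve 1 (λ x → x :* x := (:- x) :* (:- x)) refl p

0≤p*p : ∀ p → 0ℚ ≤ℚ p · p
0≤p*p p = subst (0ℚ ≤ℚ_) (sym (p*p≡∣p∣*∣p∣ p))
  (ℚₚ.nonNegative⁻¹ _ {{ℚₚ.nonNeg*nonNeg⇒nonNeg (∣ p ∣) (∣ p ∣)}})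
  where instance _ = ℚₚ.∣-∣-nonNeg p

p*p≡0⇒p≡0 : ∀ p → p · p ≡ 0ℚ → p ≡ 0ℚ
p*p≡0⇒p≡0 p pp≡0 with p ℚₚ.≟ 0ℚ
... | yes p≡0 = p≡0
... | no  p≢0 = ⊥-elim (p≢0 (begin
  p                 ≡⟨ ℚₚ.*-identityˡ p ⟨
  1ℚ · p            ≡⟨ cong (_· p) (ℚₚ.*-inverseˡ p) ⟨
  (1/ p) · p · p    ≡⟨ ℚₚ.*-assoc (1/ p) p p ⟩
  (1/ p) · (p · p)  ≡⟨ cong ((1/ p) ·_) pp≡0 ⟩
  (1/ p) · 0ℚ       ≡⟨ ℚₚ.*-zeroʳ (1/ p) ⟩
  0ℚ                ∎))
  where
  open ≡-Reasoning
  instance _ = ℚ.≢-nonZero p≢0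

0≤sum : ∀ {n} (f : Fin n → ℚ) → (∀ i → 0ℚ ≤ℚ f i) → 0ℚ ≤ℚ sumFin f
0≤sum {zero}  f 0≤f = ℚₚ.≤-refl
0≤sum {suc n} f 0≤f = ℚₚ.+-mono-≤ (0≤f zero) (0≤sum (f ∘ suc) (0≤f ∘ suc))

nonNeg-sum≡0⇒≡0 : ∀ {n} (f : Fin n → ℚ) → (∀ i → 0ℚ ≤ℚ f i) → sumFin f ≡ 0ℚ → ∀ i → f i ≡ 0ℚ
nonNeg-sum≡0⇒≡0 {suc n} f 0≤f Σf≡0 = λ where
    zero    → f₀≡0
    (suc i) → nonNeg-sum≡0⇒≡0 (f ∘ suc) (0≤f ∘ suc) rest≡0 i
  where
  rest : ℚ
  rest = sumFin (f ∘ suc)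
  f₀≤0 : f zero ≤ℚ 0ℚ
  f₀≤0 = subst₂ _≤ℚ_ (ℚₚ.+-identityʳ (f zero)) Σf≡0
    (ℚₚ.+-monoʳ-≤ (f zero) (0≤sum (f ∘ suc) (0≤f ∘ suc)))
  f₀≡0 : f zero ≡ 0ℚ
  f₀≡0 = ℚₚ.≤-antisym f₀≤0 (0≤f zero)
  rest≡0 : rest ≡ 0ℚ
  rest≡0 = trans (sym (ℚₚ.+-identityˡ rest)) (trans (cong (_+ rest) (sym f₀≡0)) Σf≡0)

sum-sq≡0⇒≡0 : ∀ {n} (f : Fin n → ℚ) → sumFin (λ i → f i · f i) ≡ 0ℚ → ∀ i → f i ≡ 0ℚ
sum-sq≡0⇒≡0 f Σff≡0 i = p*p≡0⇒p≡0 (f i) (nonNeg-sum≡0⇒≡0 (λ i → f i · f i) (0≤p*p ∘ f) Σff≡0 i)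

1+sum-sq≢0 : ∀ {n} (f : Fin n → ℚ) → ¬ (1ℚ + sumFin (λ i → f i · f i) ≡ 0ℚ)
1+sum-sq≢0 f = ℚₚ.<⇒≢ (ℚₚ.<-≤-trans (ℚₚ.positive⁻¹ 1ℚ)
  (subst (_≤ℚ 1ℚ + sumFin (λ i → f i · f i)) (ℚₚ.+-identityʳ 1ℚ)
    (ℚₚ.+-monoʳ-≤ 1ℚ (0≤sum _ (0≤p*p ∘ f))))) ∘ sym

IsMoorePenrose : ∀ {m n} → Matrix m n → Matrix n m → Set
IsMoorePenrose A X =
  A ⊗ X ⊗ A ≈ A × X ⊗ A ⊗ X ≈ X × IsSymmetric (A ⊗ X) × IsSymmetric (X ⊗ A)

IsMoorePenrose-resp : ∀ {m n} {A A′ : Matrix m n} {X : Matrix n m} →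
                      A ≈ A′ → IsMoorePenrose A X → IsMoorePenrose A′ X
IsMoorePenrose-resp {X = X} A≈A′ (AXA≈A , XAX≈X , AX-sym , XA-sym) =
  ≈-trans (≈-sym (⊗-cong (⊗-congʳ X A≈A′) A≈A′)) (≈-trans AXA≈A A≈A′) ,
  ≈-trans (≈-sym (⊗-congʳ X (⊗-congˡ X A≈A′))) XAX≈X ,
  IsSymmetric-resp (⊗-congʳ X A≈A′) AX-sym ,
  IsSymmetric-resp (⊗-congˡ X A≈A′) XA-sym

consColumn : ∀ {m k} → Matrix m 1 → Matrix m k → Matrix m (suc k)
consColumn a B i zero    = a i zero
consColumn a B i (suc j) = B i j

consRow : ∀ {m k} → Matrix 1 m → Matrix k m → Matrix (suc k) m
consRow b Y zero    l = b zero l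
consRow b Y (suc j) l = Y j l

column-⊗-row : ∀ {m p} (a : Matrix m 1) (b : Matrix 1 p) i l → (a ⊗ b) i l ≡ a i zero · b zero l
column-⊗-row a b i l = ℚₚ.+-identityʳ _

-- Greville's recursion: with d = B⁺ a and c = a − B d, a Moore–Penrose inverse of [a | B]
-- is [b ; B⁺ − d b], where b = cᵀ / cᵀc if c ≠ 0 and b = dᵀB⁺ / (1 + dᵀd) if c = 0.
module Greville {m k : ℕ} (a : Matrix m 1) (B : Matrix m k) (B⁺ : Matrix k m)
                (B⁺-mp : IsMoorePenrose B B⁺) where
  open ≡-Reasoning

  private
    BB⁺B≈B : B ⊗ B⁺ ⊗ B ≈ B
    BB⁺B≈B = proj₁ B⁺-mp
    B⁺BB⁺≈B⁺ : B⁺ ⊗ B ⊗ B⁺ ≈ B⁺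
    B⁺BB⁺≈B⁺ = proj₁ (proj₂ B⁺-mp)
    BB⁺-sym : IsSymmetric (B ⊗ B⁺)
    BB⁺-sym = proj₁ (proj₂ (proj₂ B⁺-mp))
    B⁺B-sym : IsSymmetric (B⁺ ⊗ B)
    B⁺B-sym = proj₂ (proj₂ (proj₂ B⁺-mp))

  A : Matrix m (suc k)
  A = consColumn a B

  d : Matrix k 1
  d = B⁺ ⊗ a

  c : Matrix m 1
  c = a ⊖ (B ⊗ d)

  s : ℚ
  s = ((c ᵀ) ⊗ c) zero zero

  B⁺Bd≈d : B⁺ ⊗ B ⊗ d ≈ d
  B⁺Bd≈d = ≈-trans (≈-sym (⊗-assoc (B⁺ ⊗ B) B⁺ a)) (⊗-congʳ a B⁺BB⁺≈B⁺)

  cᵀB≈0 : (c ᵀ) ⊗ B ≈ 0M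
  cᵀB≈0 i j = begin
    ((c ᵀ) ⊗ B) i j                             ≡⟨ ⊗-distribʳ-⊖ (a ᵀ) ((B ⊗ d) ᵀ) B i j ⟩
    ((a ᵀ) ⊗ B) i j - (((B ⊗ d) ᵀ) ⊗ B) i j     ≡⟨ cong (_-_ (((a ᵀ) ⊗ B) i j)) [Bd]ᵀB≡aᵀB ⟩
    ((a ᵀ) ⊗ B) i j - ((a ᵀ) ⊗ B) i j           ≡⟨ ℚₚ.+-inverseʳ (((a ᵀ) ⊗ B) i j) ⟩
    0ℚ                                          ∎
    where
    [Bd]ᵀ≈aᵀBB⁺ : ((B ⊗ d) ᵀ) ≈ (a ᵀ) ⊗ (B ⊗ B⁺)
    [Bd]ᵀ≈aᵀBB⁺ = ≈-trans (ᵀ-cong (≈-sym (⊗-assoc B B⁺ a)))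
      (≈-trans (⊗-ᵀ (B ⊗ B⁺) a) (⊗-congˡ (a ᵀ) BB⁺-sym))
    [Bd]ᵀB≡aᵀB : (((B ⊗ d) ᵀ) ⊗ B) i j ≡ ((a ᵀ) ⊗ B) i j
    [Bd]ᵀB≡aᵀB = trans (⊗-congʳ B [Bd]ᵀ≈aᵀBB⁺ i j)
      (trans (⊗-assoc (a ᵀ) (B ⊗ B⁺) B i j) (⊗-congˡ (a ᵀ) BB⁺B≈B i j))

  cᵀa≡s : ((c ᵀ) ⊗ a) zero zero ≡ s
  cᵀa≡s = begin
    ((c ᵀ) ⊗ a) zero zero               ≡⟨ ⊗-congˡ (c ᵀ) a≈c+Bd zero zero ⟩
    ((c ᵀ) ⊗ (c ⊕ (B ⊗ d))) zero zero   ≡⟨ ⊗-distribˡ-⊕ (c ᵀ) c (B ⊗ d) zero zero ⟩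
    s + ((c ᵀ) ⊗ (B ⊗ d)) zero zero     ≡⟨ cong (s +_) (trans (≈-sym (⊗-assoc (c ᵀ) B d) zero zero)
                                           (trans (⊗-congʳ d cᵀB≈0 zero zero) (⊗-zeroˡ {1} d zero zero))) ⟩
    s + 0ℚ                              ≡⟨ ℚₚ.+-identityʳ s ⟩
    s                                   ∎
    where
    a≈c+Bd : a ≈ c ⊕ (B ⊗ d)
    a≈c+Bd i j = solve 2 (λ x y → x := (x :+ (:- y)) :+ y) refl (a i j) ((B ⊗ d) i j)

  module Candidate (b : Matrix 1 m) where
    Y : Matrix k m
    Y = B⁺ ⊖ (d ⊗ b)

    X : Matrix (suc k) m
    X = consRow b Y

    AX≈BB⁺+cb : A ⊗ X ≈ (B ⊗ B⁺) ⊕ (c ⊗ b)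
    AX≈BB⁺+cb i l = begin
      a i zero · b zero l + (B ⊗ Y) i l
        ≡⟨ cong (a i zero · b zero l +_) (trans (⊗-distribˡ-⊖ B B⁺ (d ⊗ b) i l)
             (cong (_-_ ((B ⊗ B⁺) i l)) (trans (≈-sym (⊗-assoc B d b) i l) (column-⊗-row (B ⊗ d) b i l)))) ⟩
      a i zero · b zero l + ((B ⊗ B⁺) i l - (B ⊗ d) i zero · b zero l)
        ≡⟨ solve 4 (λ x β p y → x :* β :+ (p :+ (:- (y :* β))) := p :+ ((x :+ (:- y)) :* β :+ con 0ℚ))
             refl (a i zero) (b zero l) ((B ⊗ B⁺) i l) ((B ⊗ d) i zero) ⟩
      (B ⊗ B⁺) i l + ((a i zero - (B ⊗ d) i zero) · b zero l + 0ℚ) ∎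

    B⁺BY≈Y : B⁺ ⊗ B ⊗ Y ≈ Y
    B⁺BY≈Y i l = trans (⊗-distribˡ-⊖ (B⁺ ⊗ B) B⁺ (d ⊗ b) i l)
      (cong₂ _-_ (B⁺BB⁺≈B⁺ i l) (trans (≈-sym (⊗-assoc (B⁺ ⊗ B) d b) i l) (⊗-congʳ b B⁺Bd≈d i l)))

  module c≢0 {{_ : NonZero s}} where
    u : ℚ
    u = 1/ s

    b : Matrix 1 m
    b = scal u (c ᵀ)

    open Candidate b

    ba≡1 : (b ⊗ a) zero zero ≡ 1ℚ
    ba≡1 = trans (scal-⊗ u (c ᵀ) a zero zero) (trans (cong (u ·_) cᵀa≡s) (ℚₚ.*-inverseˡ s))

    bB≈0 : b ⊗ B ≈ 0M
    bB≈0 i j = trans (scal-⊗ u (c ᵀ) B i j) (trans (cong (u ·_) (cᵀB≈0 i j)) (ℚₚ.*-zeroʳ u))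

    Ya≈0 : Y ⊗ a ≈ 0M
    Ya≈0 i zero = begin
      (Y ⊗ a) i zero
        ≡⟨ ⊗-distribʳ-⊖ B⁺ (d ⊗ b) a i zero ⟩
      d i zero - (d ⊗ b ⊗ a) i zero
        ≡⟨ cong (_-_ (d i zero)) (trans (⊗-assoc d b a i zero) (column-⊗-row d (b ⊗ a) i zero)) ⟩
      d i zero - d i zero · (b ⊗ a) zero zero
        ≡⟨ cong (λ x → d i zero - d i zero · x) ba≡1 ⟩
      d i zero - d i zero · 1ℚ
        ≡⟨ solve 1 (λ x → x :+ (:- (x :* con 1ℚ)) := con 0ℚ) refl (d i zero) ⟩
      0ℚ ∎

    YB≈B⁺B : Y ⊗ B ≈ B⁺ ⊗ B
    YB≈B⁺B i j = begin
      (Y ⊗ B) i j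
        ≡⟨ ⊗-distribʳ-⊖ B⁺ (d ⊗ b) B i j ⟩
      (B⁺ ⊗ B) i j - (d ⊗ b ⊗ B) i j
        ≡⟨ cong (_-_ ((B⁺ ⊗ B) i j)) (trans (⊗-assoc d b B i j) (trans (⊗-congˡ d bB≈0 i j) (⊗-zeroʳ d i j))) ⟩
      (B⁺ ⊗ B) i j - 0ℚ
        ≡⟨ solve 1 (λ x → x :+ (:- con 0ℚ) := x) refl ((B⁺ ⊗ B) i j) ⟩
      (B⁺ ⊗ B) i j ∎

    AXA≈A : A ⊗ X ⊗ A ≈ A
    AXA≈A i zero = begin
      (A ⊗ X ⊗ a) i zero
        ≡⟨ ⊗-congʳ a AX≈BB⁺+cb i zero ⟩
      (((B ⊗ B⁺) ⊕ (c ⊗ b)) ⊗ a) i zero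
        ≡⟨ ⊗-distribʳ-⊕ (B ⊗ B⁺) (c ⊗ b) a i zero ⟩
      (B ⊗ B⁺ ⊗ a) i zero + (c ⊗ b ⊗ a) i zero
        ≡⟨ cong₂ _+_ (⊗-assoc B B⁺ a i zero) (trans (⊗-assoc c b a i zero)
             (trans (column-⊗-row c (b ⊗ a) i zero) (cong (c i zero ·_) ba≡1))) ⟩
      (B ⊗ d) i zero + c i zero · 1ℚ
        ≡⟨ solve 2 (λ y x → y :+ ((x :+ (:- y)) :* con 1ℚ) := x) refl ((B ⊗ d) i zero) (a i zero) ⟩
      a i zero ∎
    AXA≈A i (suc j) = begin
      (A ⊗ X ⊗ B) i j
        ≡⟨ ⊗-congʳ B AX≈BB⁺+cb i j ⟩
      (((B ⊗ B⁺) ⊕ (c ⊗ b)) ⊗ B) i j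
        ≡⟨ ⊗-distribʳ-⊕ (B ⊗ B⁺) (c ⊗ b) B i j ⟩
      (B ⊗ B⁺ ⊗ B) i j + (c ⊗ b ⊗ B) i j
        ≡⟨ cong₂ _+_ (BB⁺B≈B i j) (trans (⊗-assoc c b B i j) (trans (⊗-congˡ c bB≈0 i j) (⊗-zeroʳ c i j))) ⟩
      B i j + 0ℚ
        ≡⟨ ℚₚ.+-identityʳ (B i j) ⟩
      B i j ∎

    XAX≈X : X ⊗ A ⊗ X ≈ X
    XAX≈X zero l = begin
      (b ⊗ a) zero zero · b zero l + (b ⊗ B ⊗ Y) zero l
        ≡⟨ cong₂ _+_ (cong (_· b zero l) ba≡1) (trans (⊗-congʳ Y bB≈0 zero l) (⊗-zeroˡ {1} Y zero l)) ⟩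
      1ℚ · b zero l + 0ℚ
        ≡⟨ solve 1 (λ x → con 1ℚ :* x :+ con 0ℚ := x) refl (b zero l) ⟩
      b zero l ∎
    XAX≈X (suc i) l = begin
      (Y ⊗ a) i zero · b zero l + (Y ⊗ B ⊗ Y) i l
        ≡⟨ cong₂ _+_ (cong (_· b zero l) (Ya≈0 i zero)) (trans (⊗-congʳ Y YB≈B⁺B i l) (B⁺BY≈Y i l)) ⟩
      0ℚ · b zero l + Y i l
        ≡⟨ solve 2 (λ x y → con 0ℚ :* x :+ y := y) refl (b zero l) (Y i l) ⟩
      Y i l ∎

    AX-sym : IsSymmetric (A ⊗ X)
    AX-sym i l = trans (AX≈BB⁺+cb l i) (trans (cong₂ _+_ (BB⁺-sym i l)
      (solve 3 (λ x u y → x :* (u :* y) :+ con 0ℚ := y :* (u :* x) :+ con 0ℚ) refl (c l zero) u (c i zero)))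
      (sym (AX≈BB⁺+cb i l)))

    XA-sym : IsSymmetric (X ⊗ A)
    XA-sym zero    zero    = refl
    XA-sym zero    (suc j) = trans (Ya≈0 j zero) (sym (bB≈0 zero j))
    XA-sym (suc i) zero    = trans (bB≈0 zero i) (sym (Ya≈0 i zero))
    XA-sym (suc i) (suc j) = trans (YB≈B⁺B j i) (trans (B⁺B-sym i j) (sym (YB≈B⁺B i j)))

    X-mp : IsMoorePenrose A X
    X-mp = AXA≈A , XAX≈X , AX-sym , XA-sym

  module c≡0 (s≡0 : s ≡ 0ℚ) where
    q : ℚ
    q = ((d ᵀ) ⊗ d) zero zero

    t : ℚ
    t = 1ℚ + q

    instance
      _ : NonZero t
      _ = ℚ.≢-nonZero (1+sum-sq≢0 (λ j → d j zero))

    u : ℚ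
    u = 1/ t

    w : Matrix 1 m
    w = (d ᵀ) ⊗ B⁺

    b : Matrix 1 m
    b = scal u w

    open Candidate b

    c≈0 : c ≈ 0M
    c≈0 i zero = sum-sq≡0⇒≡0 (λ i → c i zero) s≡0 i

    ba≡uq : (b ⊗ a) zero zero ≡ u · q
    ba≡uq = trans (scal-⊗ u w a zero zero) (cong (u ·_) (⊗-assoc (d ᵀ) B⁺ a zero zero))

    bB≈udᵀ : b ⊗ B ≈ scal u (d ᵀ)
    bB≈udᵀ i j = trans (scal-⊗ u w B i j) (cong (u ·_) (wB≈dᵀ i j))
      where
      wB≈dᵀ : w ⊗ B ≈ (d ᵀ)
      wB≈dᵀ = ≈-trans (⊗-assoc (d ᵀ) B⁺ B) (≈-trans (⊗-congˡ (d ᵀ) (≈-sym B⁺B-sym))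
                (≈-trans (≈-sym (⊗-ᵀ (B⁺ ⊗ B) d)) (ᵀ-cong B⁺Bd≈d)))

    Ya≈ud : Y ⊗ a ≈ scal u d
    Ya≈ud i zero = begin
      (Y ⊗ a) i zero
        ≡⟨ ⊗-distribʳ-⊖ B⁺ (d ⊗ b) a i zero ⟩
      d i zero - (d ⊗ b ⊗ a) i zero
        ≡⟨ cong (_-_ (d i zero)) (trans (⊗-assoc d b a i zero) (column-⊗-row d (b ⊗ a) i zero)) ⟩
      d i zero - d i zero · (b ⊗ a) zero zero
        ≡⟨ cong (λ x → d i zero - d i zero · x) ba≡uq ⟩
      d i zero - d i zero · (u · q)
        ≡⟨ cong (λ x → x - d i zero · (u · q))
             (trans (cong (d i zero ·_) (ℚₚ.*-inverseˡ t)) (ℚₚ.*-identityʳ (d i zero))) ⟨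
      d i zero · (u · t) - d i zero · (u · q)
        ≡⟨ solve 3 (λ x u q → x :* (u :* (con 1ℚ :+ q)) :+ (:- (x :* (u :* q))) := u :* x) refl (d i zero) u q ⟩
      u · d i zero ∎

    YB≈B⁺B-udu : Y ⊗ B ≈ (B⁺ ⊗ B) ⊖ (d ⊗ scal u (d ᵀ))
    YB≈B⁺B-udu i j = trans (⊗-distribʳ-⊖ B⁺ (d ⊗ b) B i j)
      (cong (_-_ ((B⁺ ⊗ B) i j)) (trans (⊗-assoc d b B i j) (⊗-congˡ d bB≈udᵀ i j)))

    AX≈BB⁺ : A ⊗ X ≈ B ⊗ B⁺
    AX≈BB⁺ i l = trans (AX≈BB⁺+cb i l)
      (trans (cong ((B ⊗ B⁺) i l +_) (trans (⊗-congʳ b c≈0 i l) (⊗-zeroˡ b i l))) (ℚₚ.+-identityʳ _))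

    dᵀY≡w-qb : ∀ l → ((d ᵀ) ⊗ Y) zero l ≡ w zero l - q · b zero l
    dᵀY≡w-qb l = trans (⊗-distribˡ-⊖ (d ᵀ) B⁺ (d ⊗ b) zero l)
      (cong (_-_ (w zero l)) (trans (≈-sym (⊗-assoc (d ᵀ) d b) zero l) (column-⊗-row ((d ᵀ) ⊗ d) b zero l)))

    YBY≡Y-du[w-qb] : ∀ i l → (Y ⊗ B ⊗ Y) i l ≡ Y i l - d i zero · (u · (w zero l - q · b zero l))
    YBY≡Y-du[w-qb] i l = begin
      (Y ⊗ B ⊗ Y) i l
        ≡⟨ ⊗-congʳ Y YB≈B⁺B-udu i l ⟩
      (((B⁺ ⊗ B) ⊖ (d ⊗ scal u (d ᵀ))) ⊗ Y) i l
        ≡⟨ ⊗-distribʳ-⊖ (B⁺ ⊗ B) (d ⊗ scal u (d ᵀ)) Y i l ⟩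
      (B⁺ ⊗ B ⊗ Y) i l - (d ⊗ scal u (d ᵀ) ⊗ Y) i l
        ≡⟨ cong₂ _-_ (B⁺BY≈Y i l) (trans (⊗-assoc d (scal u (d ᵀ)) Y i l)
             (trans (column-⊗-row d (scal u (d ᵀ) ⊗ Y) i l)
               (cong (d i zero ·_) (trans (scal-⊗ u (d ᵀ) Y zero l) (cong (u ·_) (dᵀY≡w-qb l)))))) ⟩
      Y i l - d i zero · (u · (w zero l - q · b zero l)) ∎

    AXA≈A : A ⊗ X ⊗ A ≈ A
    AXA≈A i zero    = trans (⊗-congʳ a AX≈BB⁺ i zero)
      (trans (⊗-assoc B B⁺ a i zero) (sym (p-q≡0⇒p≡q (a i zero) ((B ⊗ d) i zero) (c≈0 i zero))))
    AXA≈A i (suc j) = trans (⊗-congʳ B AX≈BB⁺ i j) (BB⁺B≈B i j)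

    XAX≈X : X ⊗ A ⊗ X ≈ X
    XAX≈X zero l = begin
      (b ⊗ a) zero zero · b zero l + (b ⊗ B ⊗ Y) zero l
        ≡⟨ cong₂ _+_ (cong (_· b zero l) ba≡uq)
             (trans (⊗-congʳ Y bB≈udᵀ zero l) (trans (scal-⊗ u (d ᵀ) Y zero l) (cong (u ·_) (dᵀY≡w-qb l)))) ⟩
      (u · q) · (u · w zero l) + u · (w zero l - q · (u · w zero l))
        ≡⟨ solve 3 (λ u q w → (u :* q) :* (u :* w) :+ u :* (w :+ (:- (q :* (u :* w)))) := u :* w) refl u q (w zero l) ⟩
      b zero l ∎
    XAX≈X (suc i) l = begin
      (Y ⊗ a) i zero · b zero l + (Y ⊗ B ⊗ Y) i l
        ≡⟨ cong₂ _+_ (cong (_· b zero l) (Ya≈ud i zero)) (YBY≡Y-du[w-qb] i l) ⟩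
      (u · d i zero) · (u · w zero l) + (Y i l - d i zero · (u · (w zero l - q · (u · w zero l))))
        ≡⟨ solve 5 (λ u x w y q → (u :* x) :* (u :* w) :+ (y :+ (:- (x :* (u :* (w :+ (:- (q :* (u :* w))))))))
                                  := y :+ (x :* u :* w) :* (u :* (con 1ℚ :+ q) :+ (:- con 1ℚ)))
             refl u (d i zero) (w zero l) (Y i l) q ⟩
      Y i l + (d i zero · u · w zero l) · (u · t - 1ℚ)
        ≡⟨ cong (λ z → Y i l + (d i zero · u · w zero l) · (z - 1ℚ)) (ℚₚ.*-inverseˡ t) ⟩
      Y i l + (d i zero · u · w zero l) · (1ℚ - 1ℚ)
        ≡⟨ solve 2 (λ y z → y :+ z :* (con 1ℚ :+ (:- con 1ℚ)) := y) refl (Y i l) (d i zero · u · w zero l) ⟩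
      Y i l ∎

    AX-sym : IsSymmetric (A ⊗ X)
    AX-sym i l = trans (AX≈BB⁺ l i) (trans (BB⁺-sym i l) (sym (AX≈BB⁺ i l)))

    XA-sym : IsSymmetric (X ⊗ A)
    XA-sym zero    zero    = refl
    XA-sym zero    (suc j) = trans (Ya≈ud j zero) (sym (bB≈udᵀ zero j))
    XA-sym (suc i) zero    = trans (bB≈udᵀ zero i) (sym (Ya≈ud i zero))
    XA-sym (suc i) (suc j) = trans (YB≈B⁺B-udu j i) (trans (cong₂ _-_ (B⁺B-sym i j)
      (solve 3 (λ x u y → x :* (u :* y) :+ con 0ℚ := y :* (u :* x) :+ con 0ℚ) refl (d j zero) u (d i zero)))
      (sym (YB≈B⁺B-udu i j)))

    X-mp : IsMoorePenrose A X
    X-mp = AXA≈A , XAX≈X , AX-sym , XA-sym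

  greville : Σ[ X ∈ Matrix (suc k) m ] IsMoorePenrose A X
  greville with s ℚₚ.≟ 0ℚ
  ... | yes s≡0 = _ , c≡0.X-mp s≡0
  ... | no  s≢0 = _ , c≢0.X-mp {{ℚ.≢-nonZero s≢0}}

moorePenrose : ∀ {m} n (A : Matrix m n) → Σ[ X ∈ Matrix n m ] IsMoorePenrose A X
moorePenrose zero    A = (λ ()) , (λ _ ()) , (λ ()) , (λ _ _ → refl) , (λ ())
moorePenrose (suc k) A =
  let B⁺ , B⁺-mp = moorePenrose k (λ i j → A i (suc j))
      X , X-mp   = Greville.greville (λ i _ → A i zero) (λ i j → A i (suc j)) B⁺ B⁺-mp
  in X , IsMoorePenrose-resp consColumn-split X-mp
  where
  consColumn-split : consColumn (λ i _ → A i zero) (λ i j → A i (suc j)) ≈ A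
  consColumn-split i zero    = refl
  consColumn-split i (suc j) = refl

IsMoorePenrose-ᵀ : ∀ {m n} {A : Matrix m n} {X : Matrix n m} →
                   IsMoorePenrose A X → IsMoorePenrose (A ᵀ) (X ᵀ)
IsMoorePenrose-ᵀ {A = A} {X} (AXA≈A , XAX≈X , AX-sym , XA-sym) =
  ≈-trans (≈-sym (⊗-ᵀ₃ A X A)) (ᵀ-cong AXA≈A) ,
  ≈-trans (≈-sym (⊗-ᵀ₃ X A X)) (ᵀ-cong XAX≈X) ,
  IsSymmetric-resp (⊗-ᵀ X A) (λ i j → XA-sym j i) ,
  IsSymmetric-resp (⊗-ᵀ A X) (λ i j → AX-sym j i)

-- A ⊗ X is the orthogonal projector onto the column space of A.
moorePenrose-projector-unique : ∀ {m n} {A : Matrix m n} {X Y : Matrix n m} →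
  IsMoorePenrose A X → IsMoorePenrose A Y → A ⊗ X ≈ A ⊗ Y
moorePenrose-projector-unique {A = A} {X} {Y} (AXA≈A , _ , AX-sym , _) (AYA≈A , _ , AY-sym , _) =
  ≈-trans AX≈AX⊗AY (≈-sym AY≈AX⊗AY)
  where
  open ≈-Reasoning
  AX≈AX⊗AY : A ⊗ X ≈ A ⊗ X ⊗ (A ⊗ Y)
  AX≈AX⊗AY = begin
    A ⊗ X                        ≈⟨ AX-sym ⟨
    ((A ⊗ X) ᵀ)                  ≈⟨ ᵀ-cong (⊗-congʳ X AYA≈A) ⟨
    ((A ⊗ Y ⊗ A ⊗ X) ᵀ)          ≈⟨ ᵀ-cong (⊗-assoc (A ⊗ Y) A X) ⟩
    ((A ⊗ Y ⊗ (A ⊗ X)) ᵀ)        ≈⟨ ⊗-ᵀ (A ⊗ Y) (A ⊗ X) ⟩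
    ((A ⊗ X) ᵀ) ⊗ ((A ⊗ Y) ᵀ)    ≈⟨ ⊗-cong AX-sym AY-sym ⟩
    A ⊗ X ⊗ (A ⊗ Y)              ∎
  AY≈AX⊗AY : A ⊗ Y ≈ A ⊗ X ⊗ (A ⊗ Y)
  AY≈AX⊗AY = ≈-trans (⊗-congʳ Y (≈-sym AXA≈A)) (⊗-assoc (A ⊗ X) A Y)

IsMoorePenrose-unique : ∀ {m n} {A : Matrix m n} {X Y : Matrix n m} →
                        IsMoorePenrose A X → IsMoorePenrose A Y → X ≈ Y
IsMoorePenrose-unique {A = A} {X} {Y} X-mp Y-mp = begin
  X              ≈⟨ proj₁ (proj₂ X-mp) ⟨
  X ⊗ A ⊗ X      ≈⟨ ⊗-assoc X A X ⟩
  X ⊗ (A ⊗ X)    ≈⟨ ⊗-congˡ X (moorePenrose-projector-unique X-mp Y-mp) ⟩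
  X ⊗ (A ⊗ Y)    ≈⟨ ⊗-assoc X A Y ⟨
  X ⊗ A ⊗ Y      ≈⟨ ⊗-congʳ Y XA≈YA ⟩
  Y ⊗ A ⊗ Y      ≈⟨ proj₁ (proj₂ Y-mp) ⟩
  Y              ∎
  where
  open ≈-Reasoning
  XA≈YA : X ⊗ A ≈ Y ⊗ A
  XA≈YA i j = trans (⊗-ᵀ X A j i) (trans
    (moorePenrose-projector-unique (IsMoorePenrose-ᵀ X-mp) (IsMoorePenrose-ᵀ Y-mp) j i)
    (sym (⊗-ᵀ Y A j i)))

moorePenrose-symmetric : ∀ {n} {S X : Matrix n n} →
                         IsSymmetric S → IsMoorePenrose S X → IsSymmetric X
moorePenrose-symmetric S-sym X-mp =
  IsMoorePenrose-unique (IsMoorePenrose-resp S-sym (IsMoorePenrose-ᵀ X-mp)) X-mp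

IsGroupInverse-resp : ∀ {n} {S S′ X : Matrix n n} → S ≈ S′ → IsGroupInverse S X → IsGroupInverse S′ X
IsGroupInverse-resp {X = X} S≈S′ (SXS≈S , XSX≈X , SX≈XS) =
  ≈-trans (≈-sym (⊗-cong (⊗-congʳ X S≈S′) S≈S′)) (≈-trans SXS≈S S≈S′) ,
  ≈-trans (≈-sym (⊗-congʳ X (⊗-congˡ X S≈S′))) XSX≈X ,
  ≈-trans (≈-sym (⊗-congʳ X S≈S′)) (≈-trans SX≈XS (⊗-congˡ X S≈S′))

IsGroupInverse-ᵀ : ∀ {n} {S X : Matrix n n} → IsGroupInverse S X → IsGroupInverse (S ᵀ) (X ᵀ)
IsGroupInverse-ᵀ {S = S} {X} (SXS≈S , XSX≈X , SX≈XS) =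
  ≈-trans (≈-sym (⊗-ᵀ₃ S X S)) (ᵀ-cong SXS≈S) ,
  ≈-trans (≈-sym (⊗-ᵀ₃ X S X)) (ᵀ-cong XSX≈X) ,
  ≈-trans (≈-sym (⊗-ᵀ X S)) (≈-trans (ᵀ-cong (≈-sym SX≈XS)) (⊗-ᵀ S X))

-- Both S ⊗ X and S ⊗ Y equal the product S ⊗ X ⊗ (S ⊗ Y) of the two idempotents.
IsGroupInverse-unique : ∀ {n} {S X Y : Matrix n n} → IsGroupInverse S X → IsGroupInverse S Y → X ≈ Y
IsGroupInverse-unique {S = S} {X} {Y} (SXS≈S , XSX≈X , SX≈XS) (SYS≈S , YSY≈Y , SY≈YS) = begin
  X              ≈⟨ XSX≈X ⟨
  X ⊗ S ⊗ X      ≈⟨ ⊗-assoc X S X ⟩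
  X ⊗ (S ⊗ X)    ≈⟨ ⊗-congˡ X SX≈SY ⟩
  X ⊗ (S ⊗ Y)    ≈⟨ ⊗-assoc X S Y ⟨
  X ⊗ S ⊗ Y      ≈⟨ ⊗-congʳ Y (≈-trans (≈-sym SX≈XS) (≈-trans SX≈SY SY≈YS)) ⟩
  Y ⊗ S ⊗ Y      ≈⟨ YSY≈Y ⟩
  Y              ∎
  where
  open ≈-Reasoning
  SX≈SX⊗SY : S ⊗ X ≈ S ⊗ X ⊗ (S ⊗ Y)
  SX≈SX⊗SY = begin
    S ⊗ X              ≈⟨ SX≈XS ⟩
    X ⊗ S              ≈⟨ ⊗-congˡ X SYS≈S ⟨
    X ⊗ (S ⊗ Y ⊗ S)    ≈⟨ ⊗-congˡ X (⊗-assoc S Y S) ⟩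
    X ⊗ (S ⊗ (Y ⊗ S))  ≈⟨ ⊗-assoc X S (Y ⊗ S) ⟨
    X ⊗ S ⊗ (Y ⊗ S)    ≈⟨ ⊗-cong SX≈XS SY≈YS ⟨
    S ⊗ X ⊗ (S ⊗ Y)    ∎
  SY≈SX⊗SY : S ⊗ Y ≈ S ⊗ X ⊗ (S ⊗ Y)
  SY≈SX⊗SY = ≈-trans (⊗-congʳ Y (≈-sym SXS≈S)) (⊗-assoc (S ⊗ X) S Y)
  SX≈SY : S ⊗ X ≈ S ⊗ Y
  SX≈SY = ≈-trans SX≈SX⊗SY (≈-sym SY≈SX⊗SY)

groupInverse-symmetric : ∀ {n} {S X : Matrix n n} → IsSymmetric S → IsGroupInverse S X → IsSymmetric X
groupInverse-symmetric S-sym X-gi = IsGroupInverse-unique (IsGroupInverse-resp S-sym (IsGroupInverse-ᵀ X-gi)) X-gi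

-- For symmetric S the Moore–Penrose inverse is symmetric, hence commutes with S.
symmetric⇒groupInverse : ∀ {n} (S : Matrix n n) → IsSymmetric S → Σ[ X ∈ Matrix n n ] IsGroupInverse S X
symmetric⇒groupInverse {n} S S-sym = X , SXS≈S , XSX≈X , SX≈XS
  where
  open ≈-Reasoning
  X : Matrix n n
  X = proj₁ (moorePenrose n S)
  X-mp : IsMoorePenrose S X
  X-mp = proj₂ (moorePenrose n S)
  SXS≈S : S ⊗ X ⊗ S ≈ S
  SXS≈S = proj₁ X-mp
  XSX≈X : X ⊗ S ⊗ X ≈ X
  XSX≈X = proj₁ (proj₂ X-mp)
  SX≈XS : S ⊗ X ≈ X ⊗ S
  SX≈XS = begin
    S ⊗ X              ≈⟨ proj₁ (proj₂ (proj₂ X-mp)) ⟨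
    ((S ⊗ X) ᵀ)        ≈⟨ ⊗-ᵀ S X ⟩
    (X ᵀ) ⊗ (S ᵀ)      ≈⟨ ⊗-cong (moorePenrose-symmetric S-sym X-mp) S-sym ⟩
    X ⊗ S              ∎

inverse-symmetric : ∀ {n} {A A⁻¹ : Matrix n n} → IsSymmetric A → IsInverse A A⁻¹ → IsSymmetric A⁻¹
inverse-symmetric {n} {A} {A⁻¹} A-sym (AA⁻¹≈I , A⁻¹A≈I) = begin
  (A⁻¹ ᵀ)                 ≈⟨ ⊗-identityʳ (A⁻¹ ᵀ) ⟨
  (A⁻¹ ᵀ) ⊗ Id n          ≈⟨ ⊗-congˡ (A⁻¹ ᵀ) AA⁻¹≈I ⟨
  (A⁻¹ ᵀ) ⊗ (A ⊗ A⁻¹)     ≈⟨ ⊗-assoc (A⁻¹ ᵀ) A A⁻¹ ⟨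
  (A⁻¹ ᵀ) ⊗ A ⊗ A⁻¹       ≈⟨ ⊗-congʳ A⁻¹ (⊗-congˡ (A⁻¹ ᵀ) A-sym) ⟨
  (A⁻¹ ᵀ) ⊗ (A ᵀ) ⊗ A⁻¹   ≈⟨ ⊗-congʳ A⁻¹ (⊗-ᵀ A A⁻¹) ⟨
  ((A ⊗ A⁻¹) ᵀ) ⊗ A⁻¹     ≈⟨ ⊗-congʳ A⁻¹ (≈-trans (ᵀ-cong AA⁻¹≈I) (Id-symmetric n)) ⟩
  Id n ⊗ A⁻¹              ≈⟨ ⊗-identityˡ A⁻¹ ⟩
  A⁻¹                     ∎
  where open ≈-Reasoning

-- Block matrices and the Schur complement

module _ {m n : ℕ} (P : Matrix m m) (Q : Matrix m n) (R : Matrix n m) (T : Matrix n n) where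
  block-11 : ∀ i j → block P Q R T (i ↑ˡ n) (j ↑ˡ n) ≡ P i j
  block-11 i j rewrite Finₚ.splitAt-↑ˡ m i n | Finₚ.splitAt-↑ˡ m j n = refl

  block-12 : ∀ i j → block P Q R T (i ↑ˡ n) (m ↑ʳ j) ≡ Q i j
  block-12 i j rewrite Finₚ.splitAt-↑ˡ m i n | Finₚ.splitAt-↑ʳ m n j = refl

  block-21 : ∀ i j → block P Q R T (m ↑ʳ i) (j ↑ˡ n) ≡ R i j
  block-21 i j rewrite Finₚ.splitAt-↑ʳ m n i | Finₚ.splitAt-↑ˡ m j n = refl

  block-22 : ∀ i j → block P Q R T (m ↑ʳ i) (m ↑ʳ j) ≡ T i j
  block-22 i j rewrite Finₚ.splitAt-↑ʳ m n i | Finₚ.splitAt-↑ʳ m n j = refl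

≈-block : ∀ {m n} {F : Matrix (m ℕ.+ n) (m ℕ.+ n)}
            {P : Matrix m m} {Q : Matrix m n} {R : Matrix n m} {T : Matrix n n} →
          (∀ i j → F (i ↑ˡ n) (j ↑ˡ n) ≡ P i j) → (∀ i j → F (i ↑ˡ n) (m ↑ʳ j) ≡ Q i j) →
          (∀ i j → F (m ↑ʳ i) (j ↑ˡ n) ≡ R i j) → (∀ i j → F (m ↑ʳ i) (m ↑ʳ j) ≡ T i j) →
          F ≈ block P Q R T
≈-block {m} {n} {F} {P} {Q} {R} {T} F₁₁ F₁₂ F₂₁ F₂₂ x y =
  subst₂ (λ x y → F x y ≡ block P Q R T x y) (Finₚ.join-splitAt m n x) (Finₚ.join-splitAt m n y)
    (by-quadrant (splitAt m x) (splitAt m y))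
  where
  by-quadrant : ∀ u v → F (join m n u) (join m n v) ≡ block P Q R T (join m n u) (join m n v)
  by-quadrant (inj₁ i) (inj₁ j) = trans (F₁₁ i j) (sym (block-11 P Q R T i j))
  by-quadrant (inj₁ i) (inj₂ j) = trans (F₁₂ i j) (sym (block-12 P Q R T i j))
  by-quadrant (inj₂ i) (inj₁ j) = trans (F₂₁ i j) (sym (block-21 P Q R T i j))
  by-quadrant (inj₂ i) (inj₂ j) = trans (F₂₂ i j) (sym (block-22 P Q R T i j))

block-cong : ∀ {m n} {P P′ : Matrix m m} {Q Q′ : Matrix m n} {R R′ : Matrix n m} {T T′ : Matrix n n} →
             P ≈ P′ → Q ≈ Q′ → R ≈ R′ → T ≈ T′ → block P Q R T ≈ block P′ Q′ R′ T′
block-cong {P = P} {Q = Q} {R = R} {T = T} P≈P′ Q≈Q′ R≈R′ T≈T′ = ≈-block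
  (λ i j → trans (block-11 P Q R T i j) (P≈P′ i j))
  (λ i j → trans (block-12 P Q R T i j) (Q≈Q′ i j))
  (λ i j → trans (block-21 P Q R T i j) (R≈R′ i j))
  (λ i j → trans (block-22 P Q R T i j) (T≈T′ i j))

block-ᵀ : ∀ {m n} (P : Matrix m m) (Q : Matrix m n) (R : Matrix n m) (T : Matrix n n) →
          ((block P Q R T) ᵀ) ≈ block (P ᵀ) (R ᵀ) (Q ᵀ) (T ᵀ)
block-ᵀ P Q R T = ≈-block
  (λ i j → block-11 P Q R T j i) (λ i j → block-21 P Q R T j i)
  (λ i j → block-12 P Q R T j i) (λ i j → block-22 P Q R T j i)

block-⊗ : ∀ {m n} (P : Matrix m m) (Q : Matrix m n) (R : Matrix n m) (T : Matrix n n)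
          (P′ : Matrix m m) (Q′ : Matrix m n) (R′ : Matrix n m) (T′ : Matrix n n) →
          block P Q R T ⊗ block P′ Q′ R′ T′ ≈
          block ((P ⊗ P′) ⊕ (Q ⊗ R′)) ((P ⊗ Q′) ⊕ (Q ⊗ T′))
                ((R ⊗ P′) ⊕ (T ⊗ R′)) ((R ⊗ Q′) ⊕ (T ⊗ T′))
block-⊗ {m} {n} P Q R T P′ Q′ R′ T′ = ≈-block
  (quadrant (_↑ˡ n) (_↑ˡ n) (block-11 P Q R T) (block-12 P Q R T) (block-11 P′ Q′ R′ T′) (block-21 P′ Q′ R′ T′))
  (quadrant (_↑ˡ n) (m ↑ʳ_) (block-11 P Q R T) (block-12 P Q R T) (block-12 P′ Q′ R′ T′) (block-22 P′ Q′ R′ T′))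
  (quadrant (m ↑ʳ_) (_↑ˡ n) (block-21 P Q R T) (block-22 P Q R T) (block-11 P′ Q′ R′ T′) (block-21 P′ Q′ R′ T′))
  (quadrant (m ↑ʳ_) (m ↑ʳ_) (block-21 P Q R T) (block-22 P Q R T) (block-12 P′ Q′ R′ T′) (block-22 P′ Q′ R′ T′))
  where
  M M′ : Matrix (m ℕ.+ n) (m ℕ.+ n)
  M  = block P Q R T
  M′ = block P′ Q′ R′ T′
  quadrant : ∀ {p q} (f : Fin p → Fin (m ℕ.+ n)) (g : Fin q → Fin (m ℕ.+ n))
               {U : Matrix p m} {V : Matrix p n} {U′ : Matrix m q} {V′ : Matrix n q} →
             (∀ i k → M (f i) (k ↑ˡ n) ≡ U i k) → (∀ i k → M (f i) (m ↑ʳ k) ≡ V i k) →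
             (∀ k j → M′ (k ↑ˡ n) (g j) ≡ U′ k j) → (∀ k j → M′ (m ↑ʳ k) (g j) ≡ V′ k j) →
             ∀ i j → (M ⊗ M′) (f i) (g j) ≡ ((U ⊗ U′) ⊕ (V ⊗ V′)) i j
  quadrant f g MU MV M′U′ M′V′ i j = trans (sum-↑ m (λ k → M (f i) k · M′ k (g j)))
    (cong₂ _+_ (sum-cong (λ k → cong₂ _·_ (MU i k) (M′U′ k j)))
               (sum-cong (λ k → cong₂ _·_ (MV i k) (M′V′ k j))))

Is1Inverse-resp : ∀ {m n} {A A′ : Matrix m n} {X : Matrix n m} → A ≈ A′ → Is1Inverse A′ X → Is1Inverse A X
Is1Inverse-resp {X = X} A≈A′ A′XA′≈A′ =
  ≈-trans (⊗-cong (⊗-congʳ X A≈A′) A≈A′) (≈-trans A′XA′≈A′ (≈-sym A≈A′))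

module SchurComplement {m n : ℕ} (A A⁻¹ : Matrix m m) (B : Matrix m n) (C X : Matrix n n)
                       (AA⁻¹≈I : A ⊗ A⁻¹ ≈ Id m) (A⁻¹A≈I : A⁻¹ ⊗ A ≈ Id m) where
  Bᵀ : Matrix n m
  Bᵀ = B ᵀ

  K : Matrix m n
  K = A⁻¹ ⊗ B

  H V : Matrix n m
  H = Bᵀ ⊗ A⁻¹
  V = X ⊗ Bᵀ ⊗ A⁻¹

  W : Matrix m m
  W = K ⊗ X ⊗ Bᵀ ⊗ A⁻¹

  schur : Matrix n n
  schur = C ⊖ (H ⊗ B)

  block⁻ : Matrix (m ℕ.+ n) (m ℕ.+ n)
  block⁻ = block (A⁻¹ ⊕ W) (negM (K ⊗ X)) (negM V) X

  private
    S : Matrix n n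
    S = schur
    M : Matrix (m ℕ.+ n) (m ℕ.+ n)
    M = block A B Bᵀ C

    AK≈B : A ⊗ K ≈ B
    AK≈B = ≈-trans (≈-sym (⊗-assoc A A⁻¹ B)) (≈-trans (⊗-congʳ B AA⁻¹≈I) (⊗-identityˡ B))
    HA≈Bᵀ : H ⊗ A ≈ Bᵀ
    HA≈Bᵀ = ≈-trans (⊗-assoc Bᵀ A⁻¹ A) (≈-trans (⊗-congˡ Bᵀ A⁻¹A≈I) (⊗-identityʳ Bᵀ))
    W≈KV : W ≈ K ⊗ V
    W≈KV = ≈-trans (⊗-congʳ A⁻¹ (⊗-assoc K X Bᵀ)) (⊗-assoc K (X ⊗ Bᵀ) A⁻¹)
    BᵀK≈HB : Bᵀ ⊗ K ≈ H ⊗ B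
    BᵀK≈HB = ≈-sym (⊗-assoc Bᵀ A⁻¹ B)

  M⊗block⁻ : M ⊗ block⁻ ≈ block (Id m) 0M (H ⊖ (S ⊗ V)) (S ⊗ X)
  M⊗block⁻ = ≈-trans (block-⊗ A B Bᵀ C (A⁻¹ ⊕ W) (negM (K ⊗ X)) (negM V) X)
    (block-cong e₁₁ e₁₂ e₂₁ e₂₂)
    where
    AW≈BV : A ⊗ W ≈ B ⊗ V
    AW≈BV = ≈-trans (⊗-congˡ A W≈KV) (≈-trans (≈-sym (⊗-assoc A K V)) (⊗-congʳ V AK≈B))
    e₁₁ : (A ⊗ (A⁻¹ ⊕ W)) ⊕ (B ⊗ negM V) ≈ Id m
    e₁₁ i j = trans (cong₂ _+_ (trans (⊗-distribˡ-⊕ A A⁻¹ W i j) (cong₂ _+_ (AA⁻¹≈I i j) (AW≈BV i j)))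
                               (neg-distribʳ-⊗ B V i j))
      (solve 2 (λ x y → (x :+ y) :+ (:- y) := x) refl (Id m i j) ((B ⊗ V) i j))
    e₁₂ : (A ⊗ negM (K ⊗ X)) ⊕ (B ⊗ X) ≈ 0M
    e₁₂ i j = trans (cong (_+ (B ⊗ X) i j) (trans (neg-distribʳ-⊗ A (K ⊗ X) i j)
        (cong -_ (trans (≈-sym (⊗-assoc A K X) i j) (⊗-congʳ X AK≈B i j)))))
      (ℚₚ.+-inverseˡ ((B ⊗ X) i j))
    e₂₁ : (Bᵀ ⊗ (A⁻¹ ⊕ W)) ⊕ (C ⊗ negM V) ≈ H ⊖ (S ⊗ V)
    e₂₁ i j = trans (cong₂ _+_ (trans (⊗-distribˡ-⊕ Bᵀ A⁻¹ W i j) (cong (H i j +_) BᵀW≈HBV))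
                               (neg-distribʳ-⊗ C V i j))
      (trans (solve 3 (λ h g c → (h :+ g) :+ (:- c) := h :+ (:- (c :+ (:- g)))) refl
                (H i j) ((H ⊗ B ⊗ V) i j) ((C ⊗ V) i j))
        (cong (_-_ (H i j)) (sym (⊗-distribʳ-⊖ C (H ⊗ B) V i j))))
      where
      BᵀW≈HBV : (Bᵀ ⊗ W) i j ≡ (H ⊗ B ⊗ V) i j
      BᵀW≈HBV = trans (⊗-congˡ Bᵀ W≈KV i j) (trans (≈-sym (⊗-assoc Bᵀ K V) i j) (⊗-congʳ V BᵀK≈HB i j))
    e₂₂ : (Bᵀ ⊗ negM (K ⊗ X)) ⊕ (C ⊗ X) ≈ S ⊗ X
    e₂₂ i j = trans (cong (_+ (C ⊗ X) i j) (trans (neg-distribʳ-⊗ Bᵀ (K ⊗ X) i j)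
        (cong -_ (trans (≈-sym (⊗-assoc Bᵀ K X) i j) (⊗-congʳ X BᵀK≈HB i j)))))
      (trans (ℚₚ.+-comm (- (H ⊗ B ⊗ X) i j) ((C ⊗ X) i j)) (sym (⊗-distribʳ-⊖ C (H ⊗ B) X i j)))

  block⁻-is1Inverse : S ⊗ X ⊗ S ≈ S → Is1Inverse M block⁻
  block⁻-is1Inverse SXS≈S = ≈-trans (⊗-congʳ M M⊗block⁻)
    (≈-trans (block-⊗ (Id m) 0M (H ⊖ (S ⊗ V)) (S ⊗ X) A B Bᵀ C) (block-cong f₁₁ f₁₂ f₂₁ f₂₂))
    where
    open ≡-Reasoning
    f₁₁ : (Id m ⊗ A) ⊕ (0M ⊗ Bᵀ) ≈ A
    f₁₁ i j = trans (cong₂ _+_ (⊗-identityˡ A i j) (⊗-zeroˡ Bᵀ i j)) (ℚₚ.+-identityʳ _)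
    f₁₂ : (Id m ⊗ B) ⊕ (0M ⊗ C) ≈ B
    f₁₂ i j = trans (cong₂ _+_ (⊗-identityˡ B i j) (⊗-zeroˡ C i j)) (ℚₚ.+-identityʳ _)
    VA≈XBᵀ : V ⊗ A ≈ X ⊗ Bᵀ
    VA≈XBᵀ = ≈-trans (⊗-assoc (X ⊗ Bᵀ) A⁻¹ A)
      (≈-trans (⊗-congˡ (X ⊗ Bᵀ) A⁻¹A≈I) (⊗-identityʳ (X ⊗ Bᵀ)))
    f₂₁ : ((H ⊖ (S ⊗ V)) ⊗ A) ⊕ (S ⊗ X ⊗ Bᵀ) ≈ Bᵀ
    f₂₁ i j = trans (cong (_+ (S ⊗ X ⊗ Bᵀ) i j) (trans (⊗-distribʳ-⊖ H (S ⊗ V) A i j)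
                 (cong₂ _-_ (HA≈Bᵀ i j)
                   (trans (⊗-assoc S V A i j) (trans (⊗-congˡ S VA≈XBᵀ i j) (≈-sym (⊗-assoc S X Bᵀ) i j))))))
      (solve 2 (λ b z → (b :+ (:- z)) :+ z := b) refl (Bᵀ i j) ((S ⊗ X ⊗ Bᵀ) i j))
    VB≈XHB : V ⊗ B ≈ X ⊗ (H ⊗ B)
    VB≈XHB = ≈-trans (⊗-assoc (X ⊗ Bᵀ) A⁻¹ B) (≈-trans (⊗-assoc X Bᵀ K) (⊗-congˡ X BᵀK≈HB))
    f₂₂ : ((H ⊖ (S ⊗ V)) ⊗ B) ⊕ (S ⊗ X ⊗ C) ≈ C
    f₂₂ i j = begin
      ((H ⊖ (S ⊗ V)) ⊗ B) i j + (S ⊗ X ⊗ C) i j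
        ≡⟨ cong (_+ (S ⊗ X ⊗ C) i j) (trans (⊗-distribʳ-⊖ H (S ⊗ V) B i j)
             (cong (_-_ ((H ⊗ B) i j))
               (trans (⊗-assoc S V B i j) (trans (⊗-congˡ S VB≈XHB i j) (≈-sym (⊗-assoc S X (H ⊗ B)) i j))))) ⟩
      ((H ⊗ B) i j - (S ⊗ X ⊗ (H ⊗ B)) i j) + (S ⊗ X ⊗ C) i j
        ≡⟨ solve 3 (λ h g c → (h :+ (:- g)) :+ c := h :+ (c :+ (:- g))) refl
             ((H ⊗ B) i j) ((S ⊗ X ⊗ (H ⊗ B)) i j) ((S ⊗ X ⊗ C) i j) ⟩
      (H ⊗ B) i j + ((S ⊗ X ⊗ C) i j - (S ⊗ X ⊗ (H ⊗ B)) i j)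
        ≡⟨ cong ((H ⊗ B) i j +_) (trans (sym (⊗-distribˡ-⊖ (S ⊗ X) C (H ⊗ B) i j)) (SXS≈S i j)) ⟩
      (H ⊗ B) i j + (C i j - (H ⊗ B) i j)
        ≡⟨ solve 2 (λ h c → h :+ (c :+ (:- h)) := c) refl ((H ⊗ B) i j) (C i j) ⟩
      C i j ∎

  block⁻-symmetric : IsSymmetric A⁻¹ → IsSymmetric X → IsSymmetric block⁻
  block⁻-symmetric A⁻¹-sym X-sym = ≈-trans (block-ᵀ (A⁻¹ ⊕ W) (negM (K ⊗ X)) (negM V) X)
    (block-cong (λ i j → cong₂ _+_ (A⁻¹-sym i j) (W-sym i j)) (λ i j → cong -_ (Vᵀ≈KX i j))
                (λ i j → cong -_ (sym (Vᵀ≈KX j i))) X-sym)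
    where
    Kᵀ≈H : (K ᵀ) ≈ H
    Kᵀ≈H = ≈-trans (⊗-ᵀ A⁻¹ B) (⊗-congˡ Bᵀ A⁻¹-sym)
    V≈XKᵀ : V ≈ X ⊗ (K ᵀ)
    V≈XKᵀ = ≈-trans (⊗-assoc X Bᵀ A⁻¹) (⊗-congˡ X (≈-sym Kᵀ≈H))
    Vᵀ≈KX : (V ᵀ) ≈ K ⊗ X
    Vᵀ≈KX = ≈-trans (ᵀ-cong V≈XKᵀ) (≈-trans (⊗-ᵀ X (K ᵀ)) (⊗-congˡ K X-sym))
    W≈KXKᵀ : W ≈ K ⊗ X ⊗ (K ᵀ)
    W≈KXKᵀ = ≈-trans W≈KV (≈-trans (⊗-congˡ K V≈XKᵀ) (≈-sym (⊗-assoc K X (K ᵀ))))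
    W-sym : IsSymmetric W
    W-sym = IsSymmetric-resp (≈-sym W≈KXKᵀ)
      (≈-trans (⊗-ᵀ₃ K X (K ᵀ)) (⊗-congʳ (K ᵀ) (⊗-congˡ K X-sym)))

-- Matrices with a trivial kernel

TrivialKernel : ∀ {n} → Matrix n n → Set
TrivialKernel {n} M = ∀ {p} (V : Matrix n p) → M ⊗ V ≈ 0M → V ≈ 0M

-- If M X M = M then M annihilates X M − I from the left and M X − I from the right.
trivialKernel⇒inverse : ∀ {n} (M : Matrix n n) → IsSymmetric M → TrivialKernel M →
                        Σ[ X ∈ Matrix n n ] IsInverse M X
trivialKernel⇒inverse {n} M M-sym ker = X , MX≈I , XM≈I
  where
  X : Matrix n n
  X = proj₁ (moorePenrose n M)
  MXM≈M : M ⊗ X ⊗ M ≈ M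
  MXM≈M = proj₁ (proj₂ (moorePenrose n M))
  M[XM-I]≈0 : M ⊗ ((X ⊗ M) ⊖ Id n) ≈ 0M
  M[XM-I]≈0 i j = trans (⊗-distribˡ-⊖ M (X ⊗ M) (Id n) i j)
    (trans (cong₂ _-_ (trans (sym (⊗-assoc M X M i j)) (MXM≈M i j)) (⊗-identityʳ M i j))
           (ℚₚ.+-inverseʳ (M i j)))
  [MX-I]M≈0 : ((M ⊗ X) ⊖ Id n) ⊗ M ≈ 0M
  [MX-I]M≈0 i j = trans (⊗-distribʳ-⊖ (M ⊗ X) (Id n) M i j)
    (trans (cong₂ _-_ (MXM≈M i j) (⊗-identityˡ M i j)) (ℚₚ.+-inverseʳ (M i j)))
  M[MX-I]ᵀ≈0 : M ⊗ (((M ⊗ X) ⊖ Id n) ᵀ) ≈ 0M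
  M[MX-I]ᵀ≈0 = ≈-trans (⊗-congʳ (((M ⊗ X) ⊖ Id n) ᵀ) (≈-sym M-sym))
    (≈-trans (≈-sym (⊗-ᵀ ((M ⊗ X) ⊖ Id n) M)) (ᵀ-cong [MX-I]M≈0))
  XM≈I : X ⊗ M ≈ Id n
  XM≈I i j = p-q≡0⇒p≡q ((X ⊗ M) i j) (δ i j) (ker ((X ⊗ M) ⊖ Id n) M[XM-I]≈0 i j)
  MX≈I : M ⊗ X ≈ Id n
  MX≈I i j = p-q≡0⇒p≡q ((M ⊗ X) i j) (δ i j) (ker (((M ⊗ X) ⊖ Id n) ᵀ) M[MX-I]ᵀ≈0 j i)

argmax : ∀ {n} (g : Fin (suc n) → ℚ) → ∃[ a ] (∀ b → g b ≤ℚ g a)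
argmax {zero}  g = zero , λ { zero → ℚₚ.≤-refl }
argmax {suc n} g with argmax (g ∘ suc)
... | a , g∘suc≤ga with ℚₚ.≤-total (g zero) (g (suc a))
...   | inj₁ g0≤ga = suc a , λ { zero → g0≤ga ; (suc b) → g∘suc≤ga b }
...   | inj₂ ga≤g0 = zero  , λ { zero → ℚₚ.≤-refl ; (suc b) → ℚₚ.≤-trans (g∘suc≤ga b) ga≤g0 }

∣sum∣≤sum∣∣ : ∀ {n} (f : Fin n → ℚ) → ∣ sumFin f ∣ ≤ℚ sumFin (λ i → ∣ f i ∣)
∣sum∣≤sum∣∣ {zero}  f = ℚₚ.≤-refl
∣sum∣≤sum∣∣ {suc n} f = ℚₚ.≤-trans (ℚₚ.∣p+q∣≤∣p∣+∣q∣ (f zero) _)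
  (ℚₚ.+-monoʳ-≤ ∣ f zero ∣ (∣sum∣≤sum∣∣ (f ∘ suc)))

sum-mono-≤ : ∀ {n} {f g : Fin n → ℚ} → (∀ i → f i ≤ℚ g i) → sumFin f ≤ℚ sumFin g
sum-mono-≤ {zero}  f≤g = ℚₚ.≤-refl
sum-mono-≤ {suc n} f≤g = ℚₚ.+-mono-≤ (f≤g zero) (sum-mono-≤ (f≤g ∘ suc))

scal-Id-⊖-row : ∀ {n p} (κ : ℚ) (N : Matrix n n) (V : Matrix n p) a j →
                ((scal κ (Id n) ⊖ N) ⊗ V) a j ≡ κ · V a j - (N ⊗ V) a j
scal-Id-⊖-row κ N V a j = begin
  sumFin (λ b → (κ · δ a b - N a b) · V b j)
    ≡⟨ sum-cong (λ b → solve 4 (λ k d x y → (k :* d :+ (:- x)) :* y := d :* (k :* y) :+ (:- (x :* y)))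
                         refl κ (δ a b) (N a b) (V b j)) ⟩
  sumFin (λ b → δ a b · (κ · V b j) + - (N a b · V b j))
    ≡⟨ sum-+ (λ b → δ a b · (κ · V b j)) (λ b → - (N a b · V b j)) ⟩
  sumFin (λ b → δ a b · (κ · V b j)) + sumFin (λ b → - (N a b · V b j))
    ≡⟨ cong₂ _+_ (sum-δˡ a (λ b → κ · V b j)) (sym (neg-distrib-sum (λ b → N a b · V b j))) ⟩
  κ · V a j - (N ⊗ V) a j ∎
  where open ≡-Reasoning

-- For M ⊗ V ≈ 0 and μ the largest |v b| in a column v of V, the row of a maximal entry gives κ μ ≤ ρ μ.
diagonallyDominant⇒trivialKernel : ∀ {n} {M N : Matrix n n} {κ ρ : ℚ} →
  M ≈ scal κ (Id n) ⊖ N → (∀ a b → 0ℚ ≤ℚ N a b) → (∀ a → sumFin (N a) ≡ ρ) → ρ <ℚ κ →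
  TrivialKernel M
diagonallyDominant⇒trivialKernel {zero} _ _ _ _ _ _ () _
diagonallyDominant⇒trivialKernel {suc n} {M} {N} {κ} {ρ} M≈κI-N 0≤N ΣN≡ρ ρ<κ V MV≈0 a j =
  ℚₚ.∣p∣≡0⇒p≡0 (v a) (ℚₚ.≤-antisym (ℚₚ.≤-trans (maximal a) μ≤0) (ℚₚ.0≤∣p∣ (v a)))
  where
  v : Fin (suc n) → ℚ
  v b = V b j
  a* : Fin (suc n)
  a* = proj₁ (argmax (∣_∣ ∘ v))
  maximal : ∀ b → ∣ v b ∣ ≤ℚ ∣ v a* ∣
  maximal = proj₂ (argmax (∣_∣ ∘ v))
  μ : ℚ
  μ = ∣ v a* ∣
  κv≡Nv : κ · v a* ≡ (N ⊗ V) a* j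
  κv≡Nv = p-q≡0⇒p≡q _ _ (trans (sym (scal-Id-⊖-row κ N V a* j))
    (trans (sym (⊗-congʳ V M≈κI-N a* j)) (MV≈0 a* j)))
  0≤κ : 0ℚ ≤ℚ κ
  0≤κ = ℚₚ.≤-trans (subst (0ℚ ≤ℚ_) (ΣN≡ρ a*) (0≤sum (N a*) (0≤N a*))) (ℚₚ.<⇒≤ ρ<κ)
  κμ≤ρμ : κ · μ ≤ℚ ρ · μ
  κμ≤ρμ = begin
    κ · μ                               ≡⟨ cong (_· μ) (ℚₚ.0≤p⇒∣p∣≡p 0≤κ) ⟨
    ∣ κ ∣ · μ                           ≡⟨ ℚₚ.∣p*q∣≡∣p∣*∣q∣ κ (v a*) ⟨
    ∣ κ · v a* ∣                        ≡⟨ cong ∣_∣ κv≡Nv ⟩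
    ∣ (N ⊗ V) a* j ∣                    ≤⟨ ∣sum∣≤sum∣∣ (λ b → N a* b · v b) ⟩
    sumFin (λ b → ∣ N a* b · v b ∣)     ≡⟨ sum-cong (λ b → trans (ℚₚ.∣p*q∣≡∣p∣*∣q∣ (N a* b) (v b))
                                              (cong (_· ∣ v b ∣) (ℚₚ.0≤p⇒∣p∣≡p (0≤N a* b)))) ⟩
    sumFin (λ b → N a* b · ∣ v b ∣)     ≤⟨ sum-mono-≤ (λ b → ℚₚ.*-monoˡ-≤-nonNeg (N a* b)
                                              {{ℚ.nonNegative (0≤N a* b)}} (maximal b)) ⟩
    sumFin (λ b → N a* b · μ)           ≡⟨ *-distribʳ-sum μ (N a*) ⟨
    sumFin (N a*) · μ                   ≡⟨ cong (_· μ) (ΣN≡ρ a*) ⟩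
    ρ · μ                               ∎
    where open ℚₚ.≤-Reasoning
  μ≤0 : μ ≤ℚ 0ℚ
  μ≤0 = ℚₚ.≮⇒≥ λ 0<μ → ℚₚ.<-irrefl refl
    (ℚₚ.<-≤-trans (ℚₚ.*-monoˡ-<-pos μ {{ℚ.positive 0<μ}} ρ<κ) κμ≤ρμ)

ι : ℕ → ℚ
ι n = ℤ.+ n / 1

-- Rewriting ι n to its normal form mkℚ (+ n) 0 _ lets both sides be compared as fractions.
ι-suc : ∀ n → ι (suc n) ≡ 1ℚ + ι n
ι-suc n rewrite ℚₚ.normalize-coprime (coprime-sym (1-coprimeTo n)) =
  ℚₚ./-cong {ℤ.+ suc n} {1} {ℤ.+ 1 ℤ.+ (ℤ.+ n ℤ.* ℤ.+ 1)} {1}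
    (cong (ℤ._+_ (ℤ.+ 1)) (sym (ℤₚ.*-identityʳ (ℤ.+ n)))) refl

ι-+ : ∀ m n → ι (m ℕ.+ n) ≡ ι m + ι n
ι-+ zero    n = sym (ℚₚ.+-identityˡ (ι n))
ι-+ (suc m) n = trans (ι-suc (m ℕ.+ n)) (trans (cong (1ℚ +_) (ι-+ m n))
  (trans (sym (ℚₚ.+-assoc 1ℚ (ι m) (ι n))) (cong (_+ ι n) (sym (ι-suc m)))))

ι-* : ∀ m n → ι (m ℕ.* n) ≡ ι m · ι n
ι-* zero    n = sym (ℚₚ.*-zeroˡ (ι n))
ι-* (suc m) n = trans (ι-+ n (m ℕ.* n)) (trans (cong (ι n +_) (ι-* m n))
  (trans (solve 2 (λ a b → b :+ a :* b := (con 1ℚ :+ a) :* b) refl (ι m) (ι n)) (cong (_· ι n) (sym (ι-suc m)))))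

ι<ι+suc : ∀ m n → ι m <ℚ ι (m ℕ.+ suc n)
ι<ι+suc m n = subst₂ _<ℚ_ (ℚₚ.+-identityʳ (ι m)) (sym (ι-+ m (suc n)))
  (ℚₚ.+-monoʳ-< (ι m) (ℚₚ.positive⁻¹ (ι (suc n)) {{ℚₚ.normalize-pos (suc n) 1}}))

sum-const : ∀ n x → sumFin {n} (λ _ → x) ≡ ι n · x
sum-const zero    x = sym (ℚₚ.*-zeroˡ x)
sum-const (suc n) x = trans (cong (x +_) (sum-const n x))
  (trans (solve 2 (λ x a → x :+ a :* x := (con 1ℚ :+ a) :* x) refl x (ι n)) (cong (_· x) (sym (ι-suc n))))

countFin≗sum : ∀ {n} (f : Fin n → Bool) → ι (countFin f) ≡ sumFin (b2q ∘ f)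
countFin≗sum {zero}  f = refl
countFin≗sum {suc n} f = trans (ι-+ (if f zero then 1 else 0) _)
  (cong₂ _+_ (ι-if (f zero)) (countFin≗sum (f ∘ suc)))
  where
  ι-if : ∀ x → ι (if x then 1 else 0) ≡ b2q x
  ι-if true  = refl
  ι-if false = refl

b2q-if-δ : ∀ {n} (i i′ : Fin n) x → b2q (if ⌊ i ≟ i′ ⌋ then x else false) ≡ δ i i′ · b2q x
b2q-if-δ i i′ x with i ≟ i′
... | yes _ = sym (ℚₚ.*-identityˡ (b2q x))
... | no _  = sym (ℚₚ.*-zeroˡ (b2q x))

0≤b2q : ∀ x → 0ℚ ≤ℚ b2q x
0≤b2q true  = ℚₚ.nonNegative⁻¹ 1ℚ
0≤b2q false = ℚₚ.≤-refl

module _ {n : ℕ} (G : Graph n) where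
  AdjM-symmetric : IsSymmetric (AdjM G)
  AdjM-symmetric i j = cong b2q (adj-sym G j i)

  DegM-δ : ∀ i j → DegM G i j ≡ δ i j · ι (degree G i)
  DegM-δ i j = if-≟-δ i j (ι (degree G i))

  DegM-symmetric : IsSymmetric (DegM G)
  DegM-symmetric i j = trans (DegM-δ j i) (trans (cong (_· ι (degree G j)) (δ-sym j i))
    (trans (sym (δ-·-subst i j (ι ∘ degree G))) (sym (DegM-δ i j))))

  Lap-symmetric : IsSymmetric (Lap G)
  Lap-symmetric i j = cong₂ _-_ (DegM-symmetric i j) (AdjM-symmetric i j)

  L₁-symmetric : ∀ n2 → IsSymmetric (L₁ G n2)
  L₁-symmetric n2 i j = cong₂ _+_ (Lap-symmetric i j) (cong (ι n2 ·_) (DegM-symmetric i j))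

  module _ {r : ℕ} (regular : IsRegular G r) where
    AdjM-rowSum : ∀ a → sumFin (AdjM G a) ≡ ι r
    AdjM-rowSum a = trans (sym (countFin≗sum (adj G a))) (cong ι (regular a))

    L₁-regular : ∀ n2 → L₁ G n2 ≈ scal (ι (r ℕ.+ n2 ℕ.* r)) (Id n) ⊖ AdjM G
    L₁-regular n2 a b = begin
      (DegM G a b - AdjM G a b) + ι n2 · DegM G a b
        ≡⟨ cong₂ (λ x y → (x - AdjM G a b) + ι n2 · y) Dab≡δr Dab≡δr ⟩
      (δ a b · ι r - AdjM G a b) + ι n2 · (δ a b · ι r)
        ≡⟨ solve 4 (λ d r A m → (d :* r :+ (:- A)) :+ m :* (d :* r) := (r :+ m :* r) :* d :+ (:- A))
             refl (δ a b) (ι r) (AdjM G a b) (ι n2) ⟩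
      (ι r + ι n2 · ι r) · δ a b - AdjM G a b
        ≡⟨ cong (λ x → x · δ a b - AdjM G a b) (trans (ι-+ r (n2 ℕ.* r)) (cong (ι r +_) (ι-* n2 r))) ⟨
      ι (r ℕ.+ n2 ℕ.* r) · δ a b - AdjM G a b ∎
      where
      open ≡-Reasoning
      Dab≡δr : DegM G a b ≡ δ a b · ι r
      Dab≡δr = trans (DegM-δ a b) (cong (λ d → δ a b · ι d) (regular a))

    L₁-inverse : ∀ n2 → 1 ≤ r → 1 ≤ n2 → Σ[ X ∈ Matrix n n ] IsInverse (L₁ G n2) X
    L₁-inverse n2@(suc n2′) (ℕ.s≤s {n = r′} _) _ =
      trivialKernel⇒inverse (L₁ G n2) (L₁-symmetric n2)
        (diagonallyDominant⇒trivialKernel (L₁-regular n2) (λ a b → 0≤b2q (adj G a b)) AdjM-rowSum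
          (ι<ι+suc r (r′ ℕ.+ n2′ ℕ.* r)))

-- The neighbourhood corona

↑ˡ≢↑ʳ : ∀ {m n} (i : Fin m) (j : Fin n) → ¬ (i ↑ˡ n ≡ m ↑ʳ j)
↑ˡ≢↑ʳ {m} {n} i j i≡j
  with trans (sym (Finₚ.splitAt-↑ˡ m i n)) (trans (cong (splitAt m) i≡j) (Finₚ.splitAt-↑ʳ m n j))
... | ()

combine-elim : ∀ {m n} (P : Fin (m ℕ.* n) → Set) → (∀ j i → P (combine {m} {n} j i)) → ∀ c → P c
combine-elim {m} {n} P P-combine c = subst P (Finₚ.combine-remQuot {m} n c) (P-combine _ _)

kron-combine : ∀ {m n} (A : Matrix m m) (B : Matrix n n) j i j′ i′ →
               kron A B (combine j i) (combine j′ i′) ≡ A j j′ · B i i′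
kron-combine A B j i j′ i′ = cong₂ (λ p p′ → A (proj₁ p) (proj₁ p′) · B (proj₂ p) (proj₂ p′))
  (Finₚ.remQuot-combine j i) (Finₚ.remQuot-combine j′ i′)

kron-symmetric : ∀ {m n} {A : Matrix m m} {B : Matrix n n} → IsSymmetric A → IsSymmetric B →
                 IsSymmetric (kron A B)
kron-symmetric {m} {n} A-sym B-sym x y =
  cong₂ _·_ (A-sym (proj₁ (remQuot {m} n x)) (proj₁ (remQuot {m} n y)))
            (B-sym (proj₂ (remQuot {m} n x)) (proj₂ (remQuot {m} n y)))

module Corona {n1 n2 : ℕ} (G1 : Graph n1) (G2 : Graph n2) where
  private
    N : ℕ
    N = n2 ℕ.* n1
    A : Fin (n1 ℕ.+ N) → Fin (n1 ℕ.+ N) → Bool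
    A = coronaAdj G1 G2
    L : Matrix (n1 ℕ.+ N) (n1 ℕ.+ N)
    L = LapCorona G1 G2
    L2 : Matrix n1 N
    L2 = L₂ n2 G1

    v : Fin n1 → Fin (n1 ℕ.+ N)
    v a = a ↑ˡ N

    u : Fin N → Fin (n1 ℕ.+ N)
    u c = n1 ↑ʳ c

    w : Fin n2 → Fin n1 → Fin (n1 ℕ.+ N)
    w j i = u (combine j i)

    copy : Fin N → Fin n1
    copy c = proj₂ (remQuot {n2} n1 c)

  adj-vv : ∀ a b → A (v a) (v b) ≡ adj G1 a b
  adj-vv a b rewrite Finₚ.splitAt-↑ˡ n1 a N | Finₚ.splitAt-↑ˡ n1 b N = refl

  adj-vw : ∀ a c → A (v a) (u c) ≡ adj G1 a (copy c)
  adj-vw a c rewrite Finₚ.splitAt-↑ˡ n1 a N | Finₚ.splitAt-↑ʳ n1 N c = refl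

  adj-wv : ∀ c b → A (u c) (v b) ≡ adj G1 (copy c) b
  adj-wv c b rewrite Finₚ.splitAt-↑ʳ n1 N c | Finₚ.splitAt-↑ˡ n1 b N = refl

  adj-ww : ∀ j i j′ i′ → A (w j i) (w j′ i′) ≡ (if ⌊ i ≟ i′ ⌋ then adj G2 j j′ else false)
  adj-ww j i j′ i′ rewrite Finₚ.splitAt-↑ʳ n1 N (combine j i) | Finₚ.splitAt-↑ʳ n1 N (combine j′ i′) =
    cong₂ (λ p p′ → if ⌊ proj₂ p ≟ proj₂ p′ ⌋ then adj G2 (proj₁ p) (proj₁ p′) else false)
      (Finₚ.remQuot-combine j i) (Finₚ.remQuot-combine j′ i′)

  degree-split : ∀ x → ι (countFin (A x)) ≡
    sumFin (λ b → b2q (A x (v b))) + sumFin (λ j → sumFin (λ i → b2q (A x (w j i))))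
  degree-split x = trans (countFin≗sum (A x))
    (trans (sum-↑ n1 (b2q ∘ A x)) (cong (sumFin (λ b → b2q (A x (v b))) +_) (sum-combine n2 n1 (b2q ∘ A x ∘ u))))

  -- v_a keeps its neighbours in G1 and gains all copies of them in the n2 copies of G2.
  degree-v : ∀ a → ι (countFin (A (v a))) ≡ ι (degree G1 a) + ι n2 · ι (degree G1 a)
  degree-v a = trans (degree-split (v a)) (cong₂ _+_
    (trans (sum-cong (λ b → cong b2q (adj-vv a b))) (sym (countFin≗sum (adj G1 a))))
    (begin
      sumFin (λ j → sumFin (λ i → b2q (A (v a) (w j i))))
        ≡⟨ sum-cong (λ j → sum-cong (λ i → trans (cong b2q (adj-vw a (combine j i)))
             (cong (λ p → b2q (adj G1 a (proj₂ p))) (Finₚ.remQuot-combine {n2} j i)))) ⟩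
      sumFin {n2} (λ _ → sumFin (b2q ∘ adj G1 a))
        ≡⟨ sum-const n2 (sumFin (b2q ∘ adj G1 a)) ⟩
      ι n2 · sumFin (b2q ∘ adj G1 a)
        ≡⟨ cong (ι n2 ·_) (countFin≗sum (adj G1 a)) ⟨
      ι n2 · ι (degree G1 a) ∎))
    where open ≡-Reasoning

  -- w^i_j is adjacent to the neighbours of v_i in G1 and to its neighbours in the i-th copy of G2.
  degree-w : ∀ j i → ι (countFin (A (w j i))) ≡ ι (degree G1 i) + ι (degree G2 j)
  degree-w j i = trans (degree-split (w j i)) (cong₂ _+_
    (trans (sum-cong (λ b → trans (cong b2q (adj-wv (combine j i) b))
                                  (cong (λ p → b2q (adj G1 (proj₂ p) b)) (Finₚ.remQuot-combine j i))))
           (sym (countFin≗sum (adj G1 i))))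
    (trans (sum-cong (λ j′ → trans
             (sum-cong (λ i′ → trans (cong b2q (adj-ww j i j′ i′)) (b2q-if-δ i i′ (adj G2 j j′))))
             (sum-δˡ i (λ _ → b2q (adj G2 j j′)))))
           (sym (countFin≗sum (adj G2 j)))))

  L-δ : ∀ x y → L x y ≡ δ x y · ι (countFin (A x)) - b2q (A x y)
  L-δ x y = cong (_- b2q (A x y)) (if-≟-δ x y (ι (countFin (A x))))

  L-vv : ∀ a b → L (v a) (v b) ≡ L₁ G1 n2 a b
  L-vv a b = begin
    L (v a) (v b)
      ≡⟨ L-δ (v a) (v b) ⟩
    δ (v a) (v b) · ι (countFin (A (v a))) - b2q (A (v a) (v b))
      ≡⟨ cong₂ (λ x y → x · y - b2q (A (v a) (v b))) (δ-injective v (Finₚ.↑ˡ-injective N _ _) a b) (degree-v a) ⟩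
    δ a b · (d + ι n2 · d) - b2q (A (v a) (v b))
      ≡⟨ cong (_-_ (δ a b · (d + ι n2 · d))) (cong b2q (adj-vv a b)) ⟩
    δ a b · (d + ι n2 · d) - AdjM G1 a b
      ≡⟨ solve 4 (λ δ r m A → δ :* (r :+ m :* r) :+ (:- A) := (δ :* r :+ (:- A)) :+ m :* (δ :* r))
           refl (δ a b) d (ι n2) (AdjM G1 a b) ⟩
    (δ a b · d - AdjM G1 a b) + ι n2 · (δ a b · d)
      ≡⟨ cong₂ (λ x y → (x - AdjM G1 a b) + ι n2 · y) (DegM-δ G1 a b) (DegM-δ G1 a b) ⟨
    L₁ G1 n2 a b ∎
    where
    open ≡-Reasoning
    d : ℚ
    d = ι (degree G1 a)

  L-vw : ∀ a c → L (v a) (u c) ≡ L2 a c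
  L-vw a c = trans (L-δ (v a) (u c))
    (trans (cong₂ (λ x y → x · ι (countFin (A (v a))) - b2q y) (δ-≢ (↑ˡ≢↑ʳ a c)) (adj-vw a c))
      (solve 2 (λ z A → con 0ℚ :* z :+ (:- A) := :- (con 1ℚ :* A)) refl
        (ι (countFin (A (v a)))) (AdjM G1 a (copy c))))

  L-wv : ∀ c b → L (u c) (v b) ≡ L2 b c
  L-wv c b = trans (L-δ (u c) (v b))
    (trans (cong₂ (λ x y → x · ι (countFin (A (u c))) - b2q y) (δ-≢ (↑ˡ≢↑ʳ b c ∘ sym))
                  (trans (adj-wv c b) (adj-sym G1 (copy c) b)))
      (solve 2 (λ z A → con 0ℚ :* z :+ (:- A) := :- (con 1ℚ :* A)) refl
        (ι (countFin (A (u c)))) (AdjM G1 b (copy c))))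

  L-ww : ∀ j i j′ i′ → L (w j i) (w j′ i′) ≡ L₃ G1 G2 (combine j i) (combine j′ i′)
  L-ww j i j′ i′ = begin
    L x y
      ≡⟨ L-δ x y ⟩
    δ x y · ι (countFin (A x)) - b2q (A x y)
      ≡⟨ cong₂ (λ e f → e · f - b2q (A x y))
           (trans (δ-injective u (Finₚ.↑ʳ-injective n1 _ _) (combine j i) (combine j′ i′)) (δ-combine j j′ i i′))
           (degree-w j i) ⟩
    δ j j′ · δ i i′ · (d₁ + d₂) - b2q (A x y)
      ≡⟨ cong (_-_ (δ j j′ · δ i i′ · (d₁ + d₂)))
           (trans (cong b2q (adj-ww j i j′ i′)) (b2q-if-δ i i′ (adj G2 j j′))) ⟩
    δ j j′ · δ i i′ · (d₁ + d₂) - δ i i′ · AdjM G2 j j′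
      ≡⟨ solve 5 (λ δj δi r₁ r₂ A → δj :* δi :* (r₁ :+ r₂) :+ (:- (δi :* A))
                                    := (δj :* r₂ :+ (:- A)) :* δi :+ δj :* (δi :* r₁))
           refl (δ j j′) (δ i i′) d₁ d₂ (AdjM G2 j j′) ⟩
    (δ j j′ · d₂ - AdjM G2 j j′) · δ i i′ + δ j j′ · (δ i i′ · d₁)
      ≡⟨ cong₂ (λ e f → (e - AdjM G2 j j′) · δ i i′ + δ j j′ · f) (DegM-δ G2 j j′) (DegM-δ G1 i i′) ⟨
    Lap G2 j j′ · δ i i′ + δ j j′ · DegM G1 i i′
      ≡⟨ cong₂ _+_ (kron-combine (Lap G2) (Id n1) j i j′ i′) (kron-combine (Id n2) (DegM G1) j i j′ i′) ⟨
    L₃ G1 G2 (combine j i) (combine j′ i′) ∎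
    where
    open ≡-Reasoning
    x y : Fin (n1 ℕ.+ N)
    x = w j i
    y = w j′ i′
    d₁ d₂ : ℚ
    d₁ = ι (degree G1 i)
    d₂ = ι (degree G2 j)

  LapCorona-block : LapCorona G1 G2 ≈ block (L₁ G1 n2) L2 (L2 ᵀ) (L₃ G1 G2)
  LapCorona-block = ≈-block L-vv L-vw L-wv
    (combine-elim {n2} {n1} (λ c → ∀ d → L (u c) (u d) ≡ L₃ G1 G2 c d) λ j i →
      combine-elim {n2} {n1} (λ d → L (w j i) (u d) ≡ L₃ G1 G2 (combine j i) d) (L-ww j i))

  L₃-symmetric : IsSymmetric (L₃ G1 G2)
  L₃-symmetric x y = cong₂ _+_ (kron-symmetric (Lap-symmetric G2) (Id-symmetric n1) x y)
                               (kron-symmetric (Id-symmetric n2) (DegM-symmetric G1) x y)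

  -- The two signs of L₂ = −1ᵀ ⊗ A(G1) cancel.
  L₂ᵀXL₂≡AᵀXA : ∀ (X : Matrix n1 n1) c d →
                ((L2 ᵀ) ⊗ X ⊗ L2) c d ≡ ((AdjM G1 ᵀ) ⊗ X ⊗ AdjM G1) (copy c) (copy d)
  L₂ᵀXL₂≡AᵀXA X c d = sum-cong λ b → begin
    sumFin (λ a → - (1ℚ · AdjM G1 a (copy c)) · X a b) · - (1ℚ · AdjM G1 b (copy d))
      ≡⟨ cong (_· - (1ℚ · AdjM G1 b (copy d))) (trans (sum-cong (λ a →
           solve 2 (λ x y → (:- (con 1ℚ :* x)) :* y := :- (x :* y)) refl (AdjM G1 a (copy c)) (X a b)))
           (sym (neg-distrib-sum (λ a → AdjM G1 a (copy c) · X a b)))) ⟩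
    - sumFin (λ a → AdjM G1 a (copy c) · X a b) · - (1ℚ · AdjM G1 b (copy d))
      ≡⟨ solve 2 (λ s y → (:- s) :* (:- (con 1ℚ :* y)) := s :* y) refl
           (sumFin (λ a → AdjM G1 a (copy c) · X a b)) (AdjM G1 b (copy d)) ⟩
    sumFin (λ a → AdjM G1 a (copy c) · X a b) · AdjM G1 b (copy d) ∎
    where open ≡-Reasoning

  Sₘ-schur : (L1inv : Matrix n1 n1) → Sₘ G1 G2 L1inv ≈ L₃ G1 G2 ⊖ ((L2 ᵀ) ⊗ L1inv ⊗ L2)
  Sₘ-schur L1inv c d =
    cong (_-_ (L₃ G1 G2 c d)) (trans (ℚₚ.*-identityˡ _) (sym (L₂ᵀXL₂≡AᵀXA L1inv c d)))

  Sₘ-symmetric : (L1inv : Matrix n1 n1) → IsSymmetric L1inv → IsSymmetric (Sₘ G1 G2 L1inv)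
  Sₘ-symmetric L1inv L1inv-sym x y = cong₂ _-_ (L₃-symmetric x y)
    (kron-symmetric {A = J n2 n2} (λ _ _ → refl) AᵀL1invA-sym x y)
    where
    AᵀL1invA-sym : IsSymmetric ((AdjM G1 ᵀ) ⊗ L1inv ⊗ AdjM G1)
    AᵀL1invA-sym = ≈-trans (⊗-ᵀ₃ (AdjM G1 ᵀ) L1inv (AdjM G1))
      (⊗-congʳ (AdjM G1) (⊗-congˡ (AdjM G1 ᵀ) L1inv-sym))

theorem3p2 : ∀ {n1 n2 : ℕ} (G1 : Graph n1) (G2 : Graph n2) (r1 : ℕ)
    → IsRegular G1 r1 → 1 ≤ r1 → 1 ≤ n2
    → (Σ[ L1inv ∈ Matrix n1 n1 ] IsInverse (L₁ G1 n2) L1inv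
         × Σ[ Sh ∈ Matrix (n2 * n1) (n2 * n1) ]
             IsGroupInverse (Sₘ G1 G2 L1inv) Sh)
      × (∀ (L1inv : Matrix n1 n1) (Sh : Matrix (n2 * n1) (n2 * n1))
         → IsInverse (L₁ G1 n2) L1inv
         → IsGroupInverse (Sₘ G1 G2 L1inv) Sh
         → IsSymmetric (Mblock G1 G2 L1inv Sh)
           × Is1Inverse (LapCorona G1 G2) (Mblock G1 G2 L1inv Sh))
theorem3p2 {n1} {n2} G1 G2 r1 regular 1≤r1 1≤n2 = existence , blockInverse
  where
  open Corona G1 G2

  L1inv-symmetric : ∀ {L1inv} → IsInverse (L₁ G1 n2) L1inv → IsSymmetric L1inv
  L1inv-symmetric = inverse-symmetric (L₁-symmetric G1 n2)

  existence : Σ[ L1inv ∈ Matrix n1 n1 ] IsInverse (L₁ G1 n2) L1inv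
              × Σ[ Sh ∈ Matrix (n2 * n1) (n2 * n1) ] IsGroupInverse (Sₘ G1 G2 L1inv) Sh
  existence = let L1inv , L1inv-inverse = L₁-inverse G1 regular n2 1≤r1 1≤n2 in
    L1inv , L1inv-inverse ,
    symmetric⇒groupInverse (Sₘ G1 G2 L1inv) (Sₘ-symmetric L1inv (L1inv-symmetric L1inv-inverse))

  blockInverse : ∀ L1inv Sh → IsInverse (L₁ G1 n2) L1inv → IsGroupInverse (Sₘ G1 G2 L1inv) Sh →
                 IsSymmetric (Mblock G1 G2 L1inv Sh) × Is1Inverse (LapCorona G1 G2) (Mblock G1 G2 L1inv Sh)
  blockInverse L1inv Sh L1inv-inverse@(LL⁻¹≈I , L⁻¹L≈I) Sh-gi =
    block⁻-symmetric L1inv-sym (groupInverse-symmetric (Sₘ-symmetric L1inv L1inv-sym) Sh-gi) ,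
    Is1Inverse-resp LapCorona-block (block⁻-is1Inverse (proj₁ (IsGroupInverse-resp (Sₘ-schur L1inv) Sh-gi)))
    where
    open SchurComplement (L₁ G1 n2) L1inv (L₂ n2 G1) (L₃ G1 G2) Sh LL⁻¹≈I L⁻¹L≈I
    L1inv-sym : IsSymmetric L1inv
    L1inv-sym = L1inv-symmetric L1inv-inverse
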